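{- Let $E$ be a real quadratic field and $N\ge1$. Let $\eta\in\mathcal O_E^\times$ with characteristic polynomial $f_\eta(x)=x^2-tx+n\in\mathbb{Z}[x]$, and suppose $a\in(\mathbb{Z}/N\mathbb{Z})^\times$ is a root of $f_\eta$ modulo $N$. Then there exists a unital $\gamma\in\mathrm{GL}_2(\mathbb{Z})$ with $\det\gamma=n$ (the norm of $\eta$) and $$\gamma\equiv\begin{pmatrix}a&*\\0&na^{ -1}\end{pmatrix}\pmod N.$$ Conversely, if $\gamma\in\Gamma_0(N)^\pm$ is unital, then its upper-left entry modulo $N$ is a root of $f_\eta$ modulo $N$ for some $\eta\in\mathcal O_E^\times$ whose norm equals $\det\gamma$.
   Context: A matrix $\gamma\in\mathrm{GL}_2(\mathbb{Z})$ is unital if $\gamma(\beta:1)=(\beta:1)$ under the fractional linear action for some $\beta\in E\setminus\mathbb{Q}$. $\Gamma_0(N)^\pm=\{g\in\mathrm{GL}_2(\mathbb{Z}): N\text{ divides the lower-left entry}\}$. -}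

module Defs where

open import Data.Nat as ℕ using (ℕ; suc)
open import Data.Integer as ℤ using (ℤ; +_)
open import Data.Integer.Divisibility using () renaming (_∣_ to _∣ℤ_)
open import Data.Rational as ℚ using (ℚ; 0ℚ; 1ℚ)
open import Data.Product using (Σ; ∃; _×_; _,_; proj₁; proj₂)
open import Data.Sum using (_⊎_)
open import Data.List using (List; []; _∷_)
open import Relation.Binary.PropositionalEquality using (_≡_; _≢_)
open import Relation.Nullary using (¬_)

-- Squarefree natural numbers; the real quadratic field E = ℚ(√D)
-- for D squarefree, D > 1 (every real quadratic field arises this way).

Squarefree : ℕ → Set
Squarefree D = ∀ (p : ℕ) → (p ℕ.* p) Data.Nat.Divisibility.∣ D → p ≡ 1
  where import Data.Nat.Divisibility

-- An element p + q √D of E = ℚ(√D) is represented by the pair (p , q).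
-- (1, √D) is a ℚ-basis of E, so this representation is unique.
E : Set
E = ℚ × ℚ

ℤ→ℚ : ℤ → ℚ
ℤ→ℚ z = z ℚ./ 1

ι : ℚ → E
ι r = r , 0ℚ

ιℤ : ℤ → E
ιℤ z = ι (ℤ→ℚ z)

0E 1E : E
0E = ι 0ℚ
1E = ι 1ℚ

_+E_ : E → E → E
(p , q) +E (r , s) = (p ℚ.+ r) , (q ℚ.+ s)

-- multiplication in ℚ(√D):  (p + q√D)(r + s√D) = (pr + D qs) + (ps + qr)√D
mulE : ℕ → E → E → E
mulE D (p , q) (r , s) =
  (p ℚ.* r ℚ.+ ℤ→ℚ (+ D) ℚ.* q ℚ.* s) , (p ℚ.* s ℚ.+ q ℚ.* r)

NotRational : E → Set
NotRational β = proj₂ β ≢ 0ℚ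

-- Trace and norm of E/ℚ, i.e. the coefficients of the characteristic
-- polynomial x² - Tr(η) x + N(η) of multiplication by η on E (over ℚ).
trE : E → ℚ
trE (p , q) = p ℚ.+ p

normE : ℕ → E → ℚ
normE D (p , q) = p ℚ.* p ℚ.- ℤ→ℚ (+ D) ℚ.* q ℚ.* q

-- Evaluation of the monic integer polynomial
--   x^k + c_{k-1} x^{k-1} + … + c_0   (coefficient list [c_0, …, c_{k-1}])
-- at an element of E.
evalMonic : ℕ → List ℤ → E → E
evalMonic D []       x = 1E
evalMonic D (c ∷ cs) x = ιℤ c +E mulE D x (evalMonic D cs x)

InO : ℕ → E → Set
InO D α = ∃ λ (cs : List ℤ) → evalMonic D cs α ≡ 0E

IsUnitO : ℕ → E → Set
IsUnitO D η = InO D η × ∃ λ μ → InO D μ × mulE D η μ ≡ 1E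

CharPoly : ℕ → E → ℤ → ℤ → Set
CharPoly D η t n = trE η ≡ ℤ→ℚ t × normE D η ≡ ℤ→ℚ n

record M2 : Set where
  constructor mat
  field
    a b c d : ℤ
open M2 public

det : M2 → ℤ
det γ = a γ ℤ.* d γ ℤ.- b γ ℤ.* c γ

InGL2 : M2 → Set
InGL2 γ = det γ ≡ + 1 ⊎ det γ ≡ ℤ.- (+ 1)

InΓ0± : ℕ → M2 → Set
InΓ0± N γ = InGL2 γ × (+ N) ∣ℤ c γ

-- Unital: γ (β : 1) = (β : 1) in ℙ¹(E) for some β ∈ E \ ℚ, i.e.
-- (aβ + b , cβ + d) = λ (β , 1) for some λ ∈ E, λ ≠ 0.
Unital : ℕ → M2 → Set
Unital D γ = ∃ λ (β : E) → NotRational β × ∃ λ (l : E) → l ≢ 0E ×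
  (mulE D (ιℤ (a γ)) β +E ιℤ (b γ) ≡ mulE D l β) ×
  (mulE D (ιℤ (c γ)) β +E ιℤ (d γ) ≡ l)

_≡[mod_]_ : ℤ → ℕ → ℤ → Set
x ≡[mod N ] y = (+ N) ∣ℤ (x ℤ.- y)

UnitMod : ℕ → ℤ → Set
UnitMod N x = ∃ λ x' → (x ℤ.* x') ≡[mod N ] (+ 1)

RootMod : ℕ → ℤ → ℤ → ℤ → Set
RootMod N t n x = (x ℤ.* x ℤ.- t ℤ.* x ℤ.+ n) ≡[mod N ] (+ 0)

module Submission where

-- For η = P + R √D ∉ ℚ with characteristic polynomial x² - t x + n and a root x of it modulo N, write
-- x² - t x + n = k N: the matrix γ = (x, -k; N, t - x) has the same characteristic polynomial, so η is an
-- eigenvalue of γ with eigenvector (β : 1), β = (η - t + x) / N ∉ ℚ, and γ is unital.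
-- Its determinant n = N(η) is ±1 because η⁻¹ is integral: multiplying the monic equation of η⁻¹ by a power of
-- η gives η S = -1 with S ∈ ℤ[η], so n · N(S) = 1 in ℤ.
-- If η = ±1 is rational, it is replaced by ±(u + v √D) for a solution of Pell's equation u² - D v² = 1 with
-- u ≡ 1 (mod N), which has a root modulo N in common with it. Such a solution is the square of a solution for D N²,
-- and Pell's equation is solved by Dirichlet approximation of √D and two pigeonhole arguments.
-- Conversely the eigenvalue c β + d of a unital γ is a root of its characteristic polynomial, a unit because
-- det γ = ±1, and modulo N the lower-left entry vanishes, so a is a root.

open import Defs

module DiophantineApproximation where

  open import Data.Nat
  open import Data.Nat.Properties
  open import Data.Nat.Tactic.RingSolver using (solve-∀; solve)
  open import Data.Product using (_,_; _×_; ∃₂)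
  open import Data.Sum using (_⊎_; inj₁; inj₂)
  open import Data.Fin using (Fin; toℕ; fromℕ<)
  open import Data.Fin.Properties using (pigeonhole; toℕ-fromℕ<; toℕ<n)
  open import Data.List.Base using ([]; _∷_)
  open import Relation.Binary.PropositionalEquality
  open import Relation.Nullary using (yes; no; contradiction)

  square-mono-≤ : ∀ {x y} → x ≤ y → x * x ≤ y * y
  square-mono-≤ x≤y = *-mono-≤ x≤y x≤y

  square-mono-< : ∀ {x y} → x < y → x * x < y * y
  square-mono-< x<y = *-mono-< x<y x<y

  square-cancel-≤ : ∀ {x y} → x * x ≤ y * y → x ≤ y
  square-cancel-≤ {x} {y} x²≤y² with x ≤? y
  ... | yes x≤y = x≤y
  ... | no  x≰y = contradiction x²≤y² (<⇒≱ (square-mono-< (≰⇒> x≰y)))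

  square-cancel-< : ∀ {x y} → x * x < y * y → x < y
  square-cancel-< {x} {y} x²<y² with x <? y
  ... | yes x<y = x<y
  ... | no  x≮y = contradiction x²<y² (≤⇒≯ (square-mono-≤ (≮⇒≥ x≮y)))

  square-* : ∀ x y → (x * y) * (x * y) ≡ (x * x) * (y * y)
  square-* = solve-∀

  square-+ : ∀ x y → (x + y) * (x + y) ≡ x * x + 2 * (x * y) + y * y
  square-+ = solve-∀

  record IntegerSqrt (n : ℕ) : Set where
    field
      root     : ℕ
      root²≤n  : root * root ≤ n
      n<[1+root]² : n < suc root * suc root

  integerSqrt : ∀ n → IntegerSqrt n
  integerSqrt zero = record { root = 0 ; root²≤n = z≤n ; n<[1+root]² = s≤s z≤n }
  integerSqrt (suc n) with integerSqrt n
  ... | record { root = r ; root²≤n = r²≤n ; n<[1+root]² = n<[1+r]² } with suc r * suc r ≤? suc n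
  ...   | yes [1+r]²≤1+n = record
    { root = suc r ; root²≤n = [1+r]²≤1+n
    ; n<[1+root]² = ≤-<-trans n<[1+r]² (square-mono-< (n<1+n (suc r))) }
  ...   | no  [1+r]²≰1+n = record
    { root = r ; root²≤n = ≤-trans r²≤n (n≤1+n n) ; n<[1+root]² = ≰⇒> [1+r]²≰1+n }

  opaque
    ⌊√_⌋ : ℕ → ℕ
    ⌊√ n ⌋ = IntegerSqrt.root (integerSqrt n)

    ⌊√⌋-lower : ∀ n → ⌊√ n ⌋ * ⌊√ n ⌋ ≤ n
    ⌊√⌋-lower n = IntegerSqrt.root²≤n (integerSqrt n)

    ⌊√⌋-upper : ∀ n → n < suc ⌊√ n ⌋ * suc ⌊√ n ⌋
    ⌊√⌋-upper n = IntegerSqrt.n<[1+root]² (integerSqrt n)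

  ⌊√⌋-greatest : ∀ {x} n → x * x ≤ n → x ≤ ⌊√ n ⌋
  ⌊√⌋-greatest n x²≤n = s≤s⁻¹ (square-cancel-< (≤-<-trans x²≤n (⌊√⌋-upper n)))

  ∣-∣-bound : ∀ {x y e} → x ≤ y + e → y ≤ x + e → ∣ x - y ∣ ≤ e
  ∣-∣-bound {x} {y} x≤y+e y≤x+e with ∣m-n∣≡[m∸n]∨[n∸m] x y
  ... | inj₁ ∣x-y∣≡x∸y = subst (_≤ _) (sym ∣x-y∣≡x∸y) (m≤n+o⇒m∸n≤o x y x≤y+e)
  ... | inj₂ ∣x-y∣≡y∸x = subst (_≤ _) (sym ∣x-y∣≡y∸x) (m≤n+o⇒m∸n≤o y x y≤x+e)

  scale-square : ∀ Q x → Q * (Q * (x * x)) ≡ (Q * x) * (Q * x)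
  scale-square = solve-∀

  scale-square-* : ∀ Q x y → Q * (Q * (x * x * y)) ≡ (Q * x) * (Q * x) * y
  scale-square-* = solve-∀

  scale-+2* : ∀ Q x y → Q * (Q * x + 2 * y) ≡ Q * (Q * x) + 2 * (Q * y)
  scale-+2* = solve-∀

  between-suc : ∀ {G X} → G ≤ X → X ≤ suc G → X ≡ G ⊎ X ≡ suc G
  between-suc {G} G≤X X≤1+G with m≤n⇒m<n∨m≡n G≤X
  ... | inj₂ refl = inj₁ refl
  ... | inj₁ G<X  = inj₂ (≤-antisym X≤1+G G<X)

  module _ {G X Z : ℕ} (G²≤Z : G * G ≤ Z) (Z<[1+G]² : Z < suc G * suc G) where

    near-root-lower : G ≤ X → X ≤ suc G → X * X ≤ Z + 2 * X
    near-root-lower G≤X X≤1+G with between-suc G≤X X≤1+G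
    ... | inj₁ refl = ≤-trans G²≤Z (m≤m+n Z (2 * X))
    ... | inj₂ refl = begin
      suc G * suc G         ≡⟨ solve (G ∷ []) ⟩
      G * G + suc (2 * G)   ≤⟨ +-mono-≤ G²≤Z (≤-trans (n≤1+n (suc (2 * G))) (≤-reflexive (solve (G ∷ [])))) ⟩
      Z + 2 * suc G         ∎
      where open ≤-Reasoning

    near-root-upper : G ≤ X → X ≤ suc G → Z ≤ X * X + 2 * X
    near-root-upper G≤X X≤1+G with between-suc G≤X X≤1+G
    ... | inj₁ refl = s≤s⁻¹ (begin-strict
      Z                     <⟨ Z<[1+G]² ⟩
      suc G * suc G         ≡⟨ solve (G ∷ []) ⟩
      suc (G * G + 2 * G)   ∎)
      where open ≤-Reasoning
    ... | inj₂ refl = ≤-trans (<⇒≤ Z<[1+G]²) (m≤m+n (suc G * suc G) (2 * suc G))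

  module Approximation (D : ℕ) where

    ⌊_√D⌋ : ℕ → ℕ
    ⌊ c √D⌋ = ⌊√ c * c * D ⌋

    ⌊√D⌋-lower : ∀ c → ⌊ c √D⌋ * ⌊ c √D⌋ ≤ c * c * D
    ⌊√D⌋-lower c = ⌊√⌋-lower (c * c * D)

    ⌊√D⌋-upper : ∀ c → c * c * D < suc ⌊ c √D⌋ * suc ⌊ c √D⌋
    ⌊√D⌋-upper c = ⌊√⌋-upper (c * c * D)

    ⌊√D⌋-greatest : ∀ {x} c → x * x ≤ c * c * D → x ≤ ⌊ c √D⌋
    ⌊√D⌋-greatest c = ⌊√⌋-greatest (c * c * D)

    private
      square-*D : ∀ a b → (a * a * D) * (b * b * D) ≡ (a * b * D) * (a * b * D)
      square-*D a b = solve (a ∷ b ∷ D ∷ [])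

    ⌊√D⌋-*-lower : ∀ a b → ⌊ a √D⌋ * ⌊ b √D⌋ ≤ a * b * D
    ⌊√D⌋-*-lower a b = square-cancel-≤ (begin
      (⌊ a √D⌋ * ⌊ b √D⌋) * (⌊ a √D⌋ * ⌊ b √D⌋) ≡⟨ square-* ⌊ a √D⌋ ⌊ b √D⌋ ⟩
      (⌊ a √D⌋ * ⌊ a √D⌋) * (⌊ b √D⌋ * ⌊ b √D⌋) ≤⟨ *-mono-≤ (⌊√D⌋-lower a) (⌊√D⌋-lower b) ⟩
      (a * a * D) * (b * b * D)                 ≡⟨ square-*D a b ⟩
      (a * b * D) * (a * b * D)                 ∎)
      where open ≤-Reasoning

    ⌊√D⌋-*-upper : ∀ a b → a * b * D < suc ⌊ a √D⌋ * suc ⌊ b √D⌋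
    ⌊√D⌋-*-upper a b = square-cancel-< (begin-strict
      (a * b * D) * (a * b * D)                 ≡⟨ square-*D a b ⟨
      (a * a * D) * (b * b * D)                 <⟨ *-mono-< (⌊√D⌋-upper a) (⌊√D⌋-upper b) ⟩
      (suc ⌊ a √D⌋ * suc ⌊ a √D⌋) * (suc ⌊ b √D⌋ * suc ⌊ b √D⌋) ≡⟨ square-* (suc ⌊ a √D⌋) (suc ⌊ b √D⌋) ⟨
      (suc ⌊ a √D⌋ * suc ⌊ b √D⌋) * (suc ⌊ a √D⌋ * suc ⌊ b √D⌋) ∎)
      where open ≤-Reasoning

    ⌊√D⌋-superadditive : ∀ a b → ⌊ a √D⌋ + ⌊ b √D⌋ ≤ ⌊ a + b √D⌋
    ⌊√D⌋-superadditive a b = ⌊√D⌋-greatest (a + b) (begin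
      (⌊ a √D⌋ + ⌊ b √D⌋) * (⌊ a √D⌋ + ⌊ b √D⌋)
        ≡⟨ square-+ ⌊ a √D⌋ ⌊ b √D⌋ ⟩
      ⌊ a √D⌋ * ⌊ a √D⌋ + 2 * (⌊ a √D⌋ * ⌊ b √D⌋) + ⌊ b √D⌋ * ⌊ b √D⌋
        ≤⟨ +-mono-≤ (+-mono-≤ (⌊√D⌋-lower a) (*-monoʳ-≤ 2 (⌊√D⌋-*-lower a b))) (⌊√D⌋-lower b) ⟩
      a * a * D + 2 * (a * b * D) + b * b * D
        ≡⟨ solve (a ∷ b ∷ D ∷ []) ⟩
      (a + b) * (a + b) * D ∎)
      where open ≤-Reasoning

    ⌊√D⌋-subadditive : ∀ a b → ⌊ a + b √D⌋ ≤ suc (⌊ a √D⌋ + ⌊ b √D⌋)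
    ⌊√D⌋-subadditive a b = s≤s⁻¹ (square-cancel-< (begin-strict
      ⌊ a + b √D⌋ * ⌊ a + b √D⌋
        ≤⟨ ⌊√D⌋-lower (a + b) ⟩
      (a + b) * (a + b) * D
        ≡⟨ solve (a ∷ b ∷ D ∷ []) ⟩
      a * a * D + 2 * (a * b * D) + b * b * D
        <⟨ +-mono-<-≤ (+-mono-<-≤ (⌊√D⌋-upper a) (*-monoʳ-≤ 2 (<⇒≤ (⌊√D⌋-*-upper a b)))) (<⇒≤ (⌊√D⌋-upper b)) ⟩
      suc ⌊ a √D⌋ * suc ⌊ a √D⌋ + 2 * (suc ⌊ a √D⌋ * suc ⌊ b √D⌋) + suc ⌊ b √D⌋ * suc ⌊ b √D⌋
        ≡⟨ square-+ (suc ⌊ a √D⌋) (suc ⌊ b √D⌋) ⟨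
      (suc ⌊ a √D⌋ + suc ⌊ b √D⌋) * (suc ⌊ a √D⌋ + suc ⌊ b √D⌋)
        ≡⟨ cong (λ m → m * m) (+-suc (suc ⌊ a √D⌋) ⌊ b √D⌋) ⟩
      suc (suc (⌊ a √D⌋ + ⌊ b √D⌋)) * suc (suc (⌊ a √D⌋ + ⌊ b √D⌋)) ∎))
      where open ≤-Reasoning

    ⌊√D⌋-mono : ∀ {k k′} → k ≤ k′ → ⌊ k √D⌋ ≤ ⌊ k′ √D⌋
    ⌊√D⌋-mono {k} k≤k′ with m≤n⇒∃[o]m+o≡n k≤k′
    ... | o , refl = ≤-trans (m≤m+n ⌊ k √D⌋ ⌊ o √D⌋) (⌊√D⌋-superadditive k o)

    ⌊√D⌋-scale-lower : ∀ Q k → Q * ⌊ k √D⌋ ≤ ⌊ Q * k √D⌋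
    ⌊√D⌋-scale-lower Q k = ⌊√D⌋-greatest (Q * k) (begin
      (Q * ⌊ k √D⌋) * (Q * ⌊ k √D⌋) ≡⟨ square-* Q ⌊ k √D⌋ ⟩
      (Q * Q) * (⌊ k √D⌋ * ⌊ k √D⌋) ≤⟨ *-monoʳ-≤ (Q * Q) (⌊√D⌋-lower k) ⟩
      (Q * Q) * (k * k * D)         ≡⟨ solve (Q ∷ k ∷ D ∷ []) ⟩
      (Q * k) * (Q * k) * D         ∎)
      where open ≤-Reasoning

    ⌊√D⌋-scale-upper : ∀ Q k → .{{NonZero Q}} → ⌊ Q * k √D⌋ < Q * suc ⌊ k √D⌋
    ⌊√D⌋-scale-upper Q k = square-cancel-< (begin-strict
      ⌊ Q * k √D⌋ * ⌊ Q * k √D⌋         ≤⟨ ⌊√D⌋-lower (Q * k) ⟩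
      (Q * k) * (Q * k) * D             ≡⟨ solve (Q ∷ k ∷ D ∷ []) ⟩
      (Q * Q) * (k * k * D)             <⟨ *-monoʳ-< (Q * Q) {{m*n≢0 Q Q}} (⌊√D⌋-upper k) ⟩
      (Q * Q) * (suc ⌊ k √D⌋ * suc ⌊ k √D⌋) ≡⟨ square-* Q (suc ⌊ k √D⌋) ⟨
      (Q * suc ⌊ k √D⌋) * (Q * suc ⌊ k √D⌋) ∎)
      where open ≤-Reasoning

    s : ℕ
    s = ⌊√ D ⌋

    -- As p² - q²D = (p - q √D)(p + q √D), the last field says that p - q √D is roughly at most 1 / Q.
    record GoodApproximation (Q : ℕ) : Set where
      field
        p q           : ℕ
        1≤q           : 1 ≤ q
        q≤Q           : q ≤ Q
        p≤q*[1+s]     : p ≤ q * suc s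
        Q∣p²-q²D∣≤2p  : Q * ∣ p * p - q * q * D ∣ ≤ 2 * p

    -- ⌊ Q · frac (k √D) ⌋
    bucket : ℕ → ℕ → ℕ
    bucket Q k = ⌊ Q * k √D⌋ ∸ Q * ⌊ k √D⌋

    bucket<Q : ∀ Q k → .{{NonZero Q}} → bucket Q k < Q
    bucket<Q Q k = m<n+o⇒m∸n<o ⌊ Q * k √D⌋ (Q * ⌊ k √D⌋)
      (subst (⌊ Q * k √D⌋ <_) (trans (*-suc Q ⌊ k √D⌋) (+-comm Q (Q * ⌊ k √D⌋))) (⌊√D⌋-scale-upper Q k))

    ⌊√D⌋-scale-bucket : ∀ Q k → ⌊ Q * k √D⌋ ≡ Q * ⌊ k √D⌋ + bucket Q k
    ⌊√D⌋-scale-bucket Q k = sym (m+[n∸m]≡n (⌊√D⌋-scale-lower Q k))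

    -- k √D and (k + q) √D have fractional parts within 1 / Q of each other, so q √D is that close to an integer p.
    same-bucket⇒near : ∀ Q k q p → ⌊ k √D⌋ + p ≡ ⌊ k + q √D⌋ → bucket Q k ≡ bucket Q (k + q) →
                       ⌊ Q * q √D⌋ ≤ Q * p × Q * p ≤ suc ⌊ Q * q √D⌋
    same-bucket⇒near Q k q p ⌊k⌋+p≡⌊k+q⌋ same =
        +-cancelˡ-≤ ⌊ Q * k √D⌋ _ _ (begin
          ⌊ Q * k √D⌋ + ⌊ Q * q √D⌋ ≤⟨ ⌊√D⌋-superadditive (Q * k) (Q * q) ⟩
          ⌊ Q * k + Q * q √D⌋       ≡⟨ shift ⟩
          ⌊ Q * k √D⌋ + Q * p       ∎)
      , +-cancelˡ-≤ ⌊ Q * k √D⌋ _ _ (begin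
          ⌊ Q * k √D⌋ + Q * p             ≡⟨ shift ⟨
          ⌊ Q * k + Q * q √D⌋             ≤⟨ ⌊√D⌋-subadditive (Q * k) (Q * q) ⟩
          suc (⌊ Q * k √D⌋ + ⌊ Q * q √D⌋) ≡⟨ +-suc _ _ ⟨
          ⌊ Q * k √D⌋ + suc ⌊ Q * q √D⌋   ∎)
      where
      open ≤-Reasoning
      shift : ⌊ Q * k + Q * q √D⌋ ≡ ⌊ Q * k √D⌋ + Q * p
      shift = begin-equality
        ⌊ Q * k + Q * q √D⌋                  ≡⟨ cong ⌊_√D⌋ (*-distribˡ-+ Q k q) ⟨
        ⌊ Q * (k + q) √D⌋                    ≡⟨ ⌊√D⌋-scale-bucket Q (k + q) ⟩
        Q * ⌊ k + q √D⌋ + bucket Q (k + q)   ≡⟨ cong₂ (λ u v → Q * u + v) ⌊k⌋+p≡⌊k+q⌋ same ⟨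
        Q * (⌊ k √D⌋ + p) + bucket Q k       ≡⟨ regroup Q ⌊ k √D⌋ p (bucket Q k) ⟩
        (Q * ⌊ k √D⌋ + bucket Q k) + Q * p   ≡⟨ cong (_+ Q * p) (⌊√D⌋-scale-bucket Q k) ⟨
        ⌊ Q * k √D⌋ + Q * p                  ∎
        where
        regroup : ∀ Q f p b → Q * (f + p) + b ≡ (Q * f + b) + Q * p
        regroup = solve-∀

    ⌊√D⌋<*[1+s] : ∀ c → .{{NonZero c}} → ⌊ c √D⌋ < c * suc s
    ⌊√D⌋<*[1+s] c = square-cancel-< (begin-strict
      ⌊ c √D⌋ * ⌊ c √D⌋         ≤⟨ ⌊√D⌋-lower c ⟩
      c * c * D                 <⟨ *-monoʳ-< (c * c) {{m*n≢0 c c}} (⌊√⌋-upper D) ⟩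
      c * c * (suc s * suc s)   ≡⟨ square-* c (suc s) ⟨
      (c * suc s) * (c * suc s) ∎)
      where open ≤-Reasoning

    module _ (Q q p : ℕ) .{{_ : NonZero Q}} (G≤Qp : ⌊ Q * q √D⌋ ≤ Q * p) (Qp≤1+G : Q * p ≤ suc ⌊ Q * q √D⌋) where
      open ≤-Reasoning

      near⇒p≤q*[1+s] : 1 ≤ q → p ≤ q * suc s
      near⇒p≤q*[1+s] 1≤q = *-cancelˡ-≤ Q (begin
        Q * p           ≤⟨ Qp≤1+G ⟩
        suc ⌊ Q * q √D⌋ ≤⟨ ⌊√D⌋<*[1+s] (Q * q) ⟩
        Q * q * suc s   ≡⟨ *-assoc Q q (suc s) ⟩
        Q * (q * suc s) ∎)
        where
        instance
          _ : NonZero q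
          _ = >-nonZero 1≤q
          _ : NonZero (Q * q)
          _ = m*n≢0 Q q

      near⇒Q∣p²-q²D∣≤2p : Q * ∣ p * p - q * q * D ∣ ≤ 2 * p
      near⇒Q∣p²-q²D∣≤2p = begin
        Q * ∣ p * p - q * q * D ∣         ≡⟨ *-distribˡ-∣-∣ Q (p * p) (q * q * D) ⟩
        ∣ Q * (p * p) - Q * (q * q * D) ∣ ≤⟨ ∣-∣-bound Qp²≤Qq²D+2p Qq²D≤Qp²+2p ⟩
        2 * p                             ∎
        where
        lower : ⌊ Q * q √D⌋ * ⌊ Q * q √D⌋ ≤ (Q * q) * (Q * q) * D
        lower = ⌊√D⌋-lower (Q * q)
        upper : (Q * q) * (Q * q) * D < suc ⌊ Q * q √D⌋ * suc ⌊ Q * q √D⌋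
        upper = ⌊√D⌋-upper (Q * q)
        Qp²≤Qq²D+2p : Q * (p * p) ≤ Q * (q * q * D) + 2 * p
        Qp²≤Qq²D+2p = *-cancelˡ-≤ Q (begin
          Q * (Q * (p * p))                   ≡⟨ scale-square Q p ⟩
          (Q * p) * (Q * p)                   ≤⟨ near-root-lower lower upper G≤Qp Qp≤1+G ⟩
          (Q * q) * (Q * q) * D + 2 * (Q * p) ≡⟨ cong (_+ 2 * (Q * p)) (scale-square-* Q q D) ⟨
          Q * (Q * (q * q * D)) + 2 * (Q * p) ≡⟨ scale-+2* Q (q * q * D) p ⟨
          Q * (Q * (q * q * D) + 2 * p)       ∎)
        Qq²D≤Qp²+2p : Q * (q * q * D) ≤ Q * (p * p) + 2 * p
        Qq²D≤Qp²+2p = *-cancelˡ-≤ Q (begin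
          Q * (Q * (q * q * D))               ≡⟨ scale-square-* Q q D ⟩
          (Q * q) * (Q * q) * D               ≤⟨ near-root-upper lower upper G≤Qp Qp≤1+G ⟩
          (Q * p) * (Q * p) + 2 * (Q * p)     ≡⟨ cong (_+ 2 * (Q * p)) (scale-square Q p) ⟨
          Q * (Q * (p * p)) + 2 * (Q * p)     ≡⟨ scale-+2* Q (p * p) p ⟨
          Q * (Q * (p * p) + 2 * p)           ∎)

    opaque
      bucket-index : ∀ Q → .{{NonZero Q}} → Fin (suc Q) → Fin Q
      bucket-index Q i = fromℕ< (bucket<Q Q (toℕ i))

      toℕ-bucket-index : ∀ Q → .{{_ : NonZero Q}} → ∀ i → toℕ (bucket-index Q i) ≡ bucket Q (toℕ i)
      toℕ-bucket-index Q i = toℕ-fromℕ< (bucket<Q Q (toℕ i))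

    bucket-collision : ∀ Q → .{{NonZero Q}} →
                       ∃₂ λ k q → 1 ≤ q × k + q ≤ Q × bucket Q k ≡ bucket Q (k + q)
    bucket-collision Q with pigeonhole (n<1+n Q) (bucket-index Q)
    ... | i , j , i<j , same-bucket =
      k , q , m<n⇒0<n∸m i<j , subst (_≤ Q) (sym k+q≡j) (s≤s⁻¹ (toℕ<n j)) , (begin
        bucket Q k               ≡⟨ toℕ-bucket-index Q i ⟨
        toℕ (bucket-index Q i)   ≡⟨ cong toℕ same-bucket ⟩
        toℕ (bucket-index Q j)   ≡⟨ toℕ-bucket-index Q j ⟩
        bucket Q (toℕ j)         ≡⟨ cong (bucket Q) k+q≡j ⟨
        bucket Q (k + q)         ∎)
      where
      open ≡-Reasoning
      k q : ℕ
      k = toℕ i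
      q = toℕ j ∸ toℕ i
      k+q≡j : k + q ≡ toℕ j
      k+q≡j = m+[n∸m]≡n (<⇒≤ i<j)

    opaque
      dirichlet : ∀ Q → .{{NonZero Q}} → GoodApproximation Q
      dirichlet Q =
        let k , q , 1≤q , k+q≤Q , same = bucket-collision Q
            p = ⌊ k + q √D⌋ ∸ ⌊ k √D⌋
            G≤Qp , Qp≤1+G = same-bucket⇒near Q k q p (m+[n∸m]≡n (⌊√D⌋-mono (m≤m+n k q))) same
        in record
          { p = p ; q = q ; 1≤q = 1≤q ; q≤Q = ≤-trans (m≤n+m q k) k+q≤Q
          ; p≤q*[1+s] = near⇒p≤q*[1+s] Q q p G≤Qp Qp≤1+G 1≤q
          ; Q∣p²-q²D∣≤2p = near⇒Q∣p²-q²D∣≤2p Q q p G≤Qp Qp≤1+G }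

module PellSolutions where

  open import Data.Integer
  open import Data.Integer.Properties
  open import Data.Integer.Divisibility.Signed using (_∣_; divides)
  open import Data.Integer.Tactic.RingSolver using (solve-∀; solve)
  open import Data.List.Base using ([]; _∷_)
  open import Relation.Binary.PropositionalEquality

  record PellSolution (D : ℤ) : Set where
    field
      u v      : ℤ
      v≢0      : v ≢ 0ℤ
      u²-Dv²≡1 : u * u - D * (v * v) ≡ 1ℤ

  brahmagupta : ∀ D p₁ q₁ p₂ q₂ →
    (p₁ * p₂ - D * (q₁ * q₂)) * (p₁ * p₂ - D * (q₁ * q₂)) - D * ((p₁ * q₂ - q₁ * p₂) * (p₁ * q₂ - q₁ * p₂))
      ≡ (p₁ * p₁ - D * (q₁ * q₁)) * (p₂ * p₂ - D * (q₂ * q₂))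
  brahmagupta = solve-∀

  -- u + v √D is the quotient of p + q √D by p - α n + (q - β n) √D, both of norm n.
  pell-from-shifted-pair : ∀ D n p q α β → n ≢ 0ℤ →
    p * p - D * (q * q) ≡ n → (p - α * n) * (p - α * n) - D * ((q - β * n) * (q - β * n)) ≡ n →
    p * (q - β * n) - q * (p - α * n) ≢ 0ℤ → PellSolution D
  pell-from-shifted-pair D n p q α β n≢0 norm₁ norm₂ Y≢0 = record
    { u = u ; v = v ; v≢0 = v≢0
    ; u²-Dv²≡1 = *-cancelˡ-≡ (n * n) _ _ (begin
        (n * n) * (u * u - D * (v * v))             ≡⟨ scale-norm D n u v ⟩
        (u * n) * (u * n) - D * ((v * n) * (v * n)) ≡⟨ cong₂ (λ x y → x * x - D * (y * y)) X≡un Y≡vn ⟨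
        X * X - D * (Y * Y)                         ≡⟨ brahmagupta D p q (p - α * n) (q - β * n) ⟩
        (p * p - D * (q * q)) * ((p - α * n) * (p - α * n) - D * ((q - β * n) * (q - β * n)))
                                                    ≡⟨ cong₂ _*_ norm₁ norm₂ ⟩
        n * n                                       ≡⟨ *-identityʳ (n * n) ⟨
        (n * n) * 1ℤ                                ∎) }
    where
    open ≡-Reasoning
    instance
      _ : NonZero n
      _ = ≢-nonZero n≢0
      _ : NonZero (n * n)
      _ = i*j≢0 n n
    X Y u v : ℤ
    X = p * (p - α * n) - D * (q * (q - β * n))
    Y = p * (q - β * n) - q * (p - α * n)
    u = 1ℤ - α * p + β * D * q
    v = α * q - β * p
    scale-norm : ∀ D n u v → (n * n) * (u * u - D * (v * v)) ≡ (u * n) * (u * n) - D * ((v * n) * (v * n))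
    scale-norm = solve-∀
    X≡un : X ≡ u * n
    X≡un = begin
      p * (p - α * n) - D * (q * (q - β * n))       ≡⟨ solve (D ∷ n ∷ p ∷ q ∷ α ∷ β ∷ []) ⟩
      (p * p - D * (q * q)) + (β * D * q - α * p) * n ≡⟨ cong (_+ (β * D * q - α * p) * n) norm₁ ⟩
      n + (β * D * q - α * p) * n                   ≡⟨ solve (D ∷ n ∷ p ∷ q ∷ α ∷ β ∷ []) ⟩
      (1ℤ - α * p + β * D * q) * n                  ∎
    Y≡vn : p * (q - β * n) - q * (p - α * n) ≡ (α * q - β * p) * n
    Y≡vn = solve (n ∷ p ∷ q ∷ α ∷ β ∷ [])
    v≢0 : v ≢ 0ℤ
    v≢0 v≡0 = Y≢0 (trans Y≡vn (trans (cong (_* n) v≡0) (*-zeroˡ n)))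

  x-y≡z⇒y≡x-z : ∀ x y {z} → x - y ≡ z → y ≡ x - z
  x-y≡z⇒y≡x-z x y refl = solve (x ∷ y ∷ [])

  congruent-same-norm⇒pell : ∀ D n p₁ q₁ p₂ q₂ → n ≢ 0ℤ →
    p₁ * p₁ - D * (q₁ * q₁) ≡ n → p₂ * p₂ - D * (q₂ * q₂) ≡ n →
    n ∣ p₁ - p₂ → n ∣ q₁ - q₂ → p₁ * q₂ - q₁ * p₂ ≢ 0ℤ → PellSolution D
  congruent-same-norm⇒pell D n p₁ q₁ p₂ q₂ n≢0 norm₁ norm₂ (divides α p₁-p₂≡αn) (divides β q₁-q₂≡βn) Y≢0
    with refl ← x-y≡z⇒y≡x-z p₁ p₂ p₁-p₂≡αn | refl ← x-y≡z⇒y≡x-z q₁ q₂ q₁-q₂≡βn =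
    pell-from-shifted-pair D n p₁ q₁ α β n≢0 norm₁ norm₂ Y≢0

  proportional-same-norm⇒q²≡q² : ∀ D n p₁ q₁ p₂ q₂ → n ≢ 0ℤ →
    p₁ * p₁ - D * (q₁ * q₁) ≡ n → p₂ * p₂ - D * (q₂ * q₂) ≡ n →
    p₁ * q₂ ≡ q₁ * p₂ → q₂ * q₂ ≡ q₁ * q₁
  proportional-same-norm⇒q²≡q² D n p₁ q₁ p₂ q₂ n≢0 norm₁ norm₂ p₁q₂≡q₁p₂ =
    *-cancelˡ-≡ n _ _ {{≢-nonZero n≢0}} (begin
      n * (q₂ * q₂)                                     ≡⟨ cong (_* (q₂ * q₂)) norm₁ ⟨
      (p₁ * p₁ - D * (q₁ * q₁)) * (q₂ * q₂)             ≡⟨ solve (D ∷ p₁ ∷ q₁ ∷ q₂ ∷ []) ⟩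
      (p₁ * q₂) * (p₁ * q₂) - D * (q₁ * q₁) * (q₂ * q₂) ≡⟨ cong (λ z → z * z - D * (q₁ * q₁) * (q₂ * q₂)) p₁q₂≡q₁p₂ ⟩
      (q₁ * p₂) * (q₁ * p₂) - D * (q₁ * q₁) * (q₂ * q₂) ≡⟨ solve (D ∷ q₁ ∷ p₂ ∷ q₂ ∷ []) ⟩
      (p₂ * p₂ - D * (q₂ * q₂)) * (q₁ * q₁)             ≡⟨ cong (_* (q₁ * q₁)) norm₂ ⟩
      n * (q₁ * q₁)                                     ∎)
    where open ≡-Reasoning

module PellEquation where

  open import Data.Nat
  open import Data.Nat.Properties
  open import Data.Nat.DivMod using (_%_; _/_; m%n<n; m≡m%n+[m/n]*n)
  open import Data.Nat.Divisibility as ℕ using (m≤n⇒m!∣n!; m∣m*n)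
  open import Data.Integer as ℤ using (ℤ; +_; _⊖_)
  import Data.Integer.Properties as ℤ
  open import Data.Integer.Divisibility.Signed as ℤ using (divides; ∣ᵤ⇒∣)
  open import Data.Integer.Tactic.RingSolver using (solve-∀)
  open import Data.Fin using (Fin; toℕ; fromℕ<; combine; remQuot)
  open import Data.Fin.Properties using (pigeonhole; fromℕ<-injective; remQuot-combine)
  open import Data.Product using (_,_; _×_)
  open import Data.Sum using (inj₁; inj₂)
  open import Relation.Binary.PropositionalEquality
  open import Relation.Nullary using (¬_)

  open import Algebra.Properties.CommutativeSemigroup *-commutativeSemigroup using (x∙yz≈y∙xz)

  open DiophantineApproximation
  open PellSolutions

  m⊖n≡[m∸n]⊖[n∸m] : ∀ m n → m ⊖ n ≡ (m ∸ n) ⊖ (n ∸ m)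
  m⊖n≡[m∸n]⊖[n∸m] m n with ≤-total m n
  ... | inj₁ m≤n rewrite m≤n⇒m∸n≡0 m≤n = trans (ℤ.⊖-≤ m≤n) (sym (ℤ.⊖-≤ z≤n))
  ... | inj₂ n≤m rewrite m≤n⇒m∸n≡0 n≤m = trans (ℤ.⊖-≥ n≤m) (sym (ℤ.⊖-≥ z≤n))

  ∣m⊖n∣≡∣m-n∣ : ∀ m n → ℤ.∣ m ⊖ n ∣ ≡ ∣ m - n ∣
  ∣m⊖n∣≡∣m-n∣ m n with ≤-total m n
  ... | inj₁ m≤n = trans (ℤ.∣⊖∣-≤ m≤n) (sym (m≤n⇒∣m-n∣≡n∸m m≤n))
  ... | inj₂ n≤m = trans (ℤ.∣m⊖n∣≡∣n⊖m∣ m n) (trans (ℤ.∣⊖∣-≤ n≤m) (sym (m≤n⇒∣n-m∣≡n∸m n≤m)))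

  pos-norm : ∀ D p q → + p ℤ.* + p ℤ.- + D ℤ.* (+ q ℤ.* + q) ≡ (p * p) ⊖ (q * q * D)
  pos-norm D p q = begin
    + p ℤ.* + p ℤ.- + D ℤ.* (+ q ℤ.* + q)
      ≡⟨ cong₂ ℤ._-_ (ℤ.pos-* p p) (trans (ℤ.pos-* D (q * q)) (cong (λ x → + D ℤ.* x) (ℤ.pos-* q q))) ⟨
    + (p * p) ℤ.- + (D * (q * q))         ≡⟨ cong (λ x → + (p * p) ℤ.- + x) (*-comm D (q * q)) ⟩
    + (p * p) ℤ.- + (q * q * D)           ≡⟨ ℤ.[+m]-[+n]≡m⊖n (p * p) (q * q * D) ⟩
    (p * p) ⊖ (q * q * D)                 ∎
    where open ≡-Reasoning

  %-equal⇒∣- : ∀ a b K → .{{_ : NonZero K}} → a % K ≡ b % K → + K ℤ.∣ + a ℤ.- + b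
  %-equal⇒∣- a b K a%K≡b%K = divides (+ (a / K) ℤ.- + (b / K)) (begin
    + a ℤ.- + b
      ≡⟨ cong₂ (λ x y → + x ℤ.- + y) (m≡m%n+[m/n]*n a K) (m≡m%n+[m/n]*n b K) ⟩
    + (a % K + a / K * K) ℤ.- + (b % K + b / K * K)
      ≡⟨ cong (λ r → + (r + a / K * K) ℤ.- + (b % K + b / K * K)) a%K≡b%K ⟩
    + (b % K + a / K * K) ℤ.- + (b % K + b / K * K)
      ≡⟨ cong₂ ℤ._-_ (embed (b % K) (a / K)) (embed (b % K) (b / K)) ⟩
    (+ (b % K) ℤ.+ + (a / K) ℤ.* + K) ℤ.- (+ (b % K) ℤ.+ + (b / K) ℤ.* + K)
      ≡⟨ cancel (+ (b % K)) (+ (a / K)) (+ (b / K)) (+ K) ⟩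
    (+ (a / K) ℤ.- + (b / K)) ℤ.* + K ∎)
    where
    open ≡-Reasoning
    embed : ∀ r x → + (r + x * K) ≡ + r ℤ.+ + x ℤ.* + K
    embed r x = trans (ℤ.pos-+ r (x * K)) (cong (λ y → + r ℤ.+ y) (ℤ.pos-* x K))
    cancel : ∀ r x y k → (r ℤ.+ x ℤ.* k) ℤ.- (r ℤ.+ y ℤ.* k) ≡ (x ℤ.- y) ℤ.* k
    cancel = solve-∀

  n∣n! : ∀ {n} → 1 ≤ n → n ℕ.∣ n !
  n∣n! {suc n} _ = m∣m*n (n !)

  combine-injective : ∀ {m n} {i i′ : Fin m} {j j′ : Fin n} → combine i j ≡ combine i′ j′ → i ≡ i′ × j ≡ j′
  combine-injective {n = n} {i} {i′} {j} {j′} eq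
    with refl ← trans (sym (remQuot-combine {k = n} i j)) (trans (cong (remQuot n) eq) (remQuot-combine i′ j′))
    = refl , refl

  same-norm-proportional⇒≡ : ∀ D {p₁ q₁ p₂ q₂} → 1 ≤ q₂ → (p₁ * p₁) ⊖ (q₁ * q₁ * D) ≢ ℤ.0ℤ →
    (p₁ * p₁) ⊖ (q₁ * q₁ * D) ≡ (p₂ * p₂) ⊖ (q₂ * q₂ * D) →
    + p₁ ℤ.* + q₂ ℤ.- + q₁ ℤ.* + p₂ ≡ ℤ.0ℤ → p₁ ≡ p₂
  same-norm-proportional⇒≡ D {p₁} {q₁} {p₂} {q₂} 1≤q₂ n≢0 same-norm Y≡0 =
    *-cancelʳ-≡ p₁ p₂ q₂ {{>-nonZero 1≤q₂}} (trans p₁q₂≡q₁p₂ (trans (cong (_* p₂) q₁≡q₂) (*-comm q₂ p₂)))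
    where
    p₁q₂≡q₁p₂ : p₁ * q₂ ≡ q₁ * p₂
    p₁q₂≡q₁p₂ = ℤ.+-injective (trans (ℤ.pos-* p₁ q₂) (trans (ℤ.i-j≡0⇒i≡j _ _ Y≡0) (sym (ℤ.pos-* q₁ p₂))))
    q₂²≡q₁² : q₂ * q₂ ≡ q₁ * q₁
    q₂²≡q₁² = ℤ.+-injective (trans (ℤ.pos-* q₂ q₂) (trans
      (proportional-same-norm⇒q²≡q² (+ D) _ (+ p₁) (+ q₁) (+ p₂) (+ q₂) n≢0
        (pos-norm D p₁ q₁) (trans (pos-norm D p₂ q₂) (sym same-norm))
        (trans (sym (ℤ.pos-* p₁ q₂)) (trans (cong +_ p₁q₂≡q₁p₂) (ℤ.pos-* q₁ p₂))))
      (sym (ℤ.pos-* q₁ q₁))))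
    q₁≡q₂ : q₁ ≡ q₂
    q₁≡q₂ = ≤-antisym (square-cancel-≤ (≤-reflexive (sym q₂²≡q₁²))) (square-cancel-≤ (≤-reflexive q₂²≡q₁²))

  module Pell (D : ℕ) (nonsquare : ∀ p q → 1 ≤ q → p * p ≢ q * q * D) where
    open Approximation D
    open GoodApproximation

    M : ℕ
    M = 2 * suc s

    K : ℕ
    K = M !

    module _ {Q : ℕ} .{{_ : NonZero Q}} (g : GoodApproximation Q) where

      ∣p²-q²D∣≤M : ∣ p g * p g - q g * q g * D ∣ ≤ M
      ∣p²-q²D∣≤M = *-cancelˡ-≤ Q (begin
        Q * ∣ p g * p g - q g * q g * D ∣ ≤⟨ Q∣p²-q²D∣≤2p g ⟩
        2 * p g                           ≤⟨ *-monoʳ-≤ 2 (≤-trans (p≤q*[1+s] g) (*-monoˡ-≤ (suc s) (q≤Q g))) ⟩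
        2 * (Q * suc s)                   ≡⟨ x∙yz≈y∙xz 2 Q (suc s) ⟩
        Q * M                             ∎)
        where open ≤-Reasoning

      not-too-good : ¬ (2 * p g < Q)
      not-too-good 2p<Q = nonsquare (p g) (q g) (1≤q g) (∣m-n∣≡0⇒m≡n (n<1⇒n≡0 (*-cancelˡ-< Q _ _ (begin-strict
        Q * ∣ p g * p g - q g * q g * D ∣ ≤⟨ Q∣p²-q²D∣≤2p g ⟩
        2 * p g                           <⟨ 2p<Q ⟩
        Q                                 ≡⟨ *-identityʳ Q ⟨
        Q * 1                             ∎))))
        where open ≤-Reasoning

      norm : ℤ
      norm = (p g * p g) ⊖ (q g * q g * D)

      ∣norm∣≡∣p²-q²D∣ : ℤ.∣ norm ∣ ≡ ∣ p g * p g - q g * q g * D ∣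
      ∣norm∣≡∣p²-q²D∣ = ∣m⊖n∣≡∣m-n∣ (p g * p g) (q g * q g * D)

      norm≢0 : norm ≢ ℤ.0ℤ
      norm≢0 norm≡0 = nonsquare (p g) (q g) (1≤q g)
        (∣m-n∣≡0⇒m≡n (trans (sym ∣norm∣≡∣p²-q²D∣) (cong ℤ.∣_∣ norm≡0)))

      norm∣K : norm ℤ.∣ + K
      norm∣K = ∣ᵤ⇒∣ (ℕ.∣-trans (n∣n! 1≤∣norm∣) (m≤n⇒m!∣n! ∣norm∣≤M))
        where
        ∣norm∣≤M : ℤ.∣ norm ∣ ≤ M
        ∣norm∣≤M = subst (_≤ M) (sym ∣norm∣≡∣p²-q²D∣) ∣p²-q²D∣≤M
        1≤∣norm∣ : 1 ≤ ℤ.∣ norm ∣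
        1≤∣norm∣ = n≢0⇒n>0 (λ ∣norm∣≡0 → norm≢0 (ℤ.∣i∣≡0⇒i≡0 ∣norm∣≡0))

    mutual
      level : ℕ → ℕ
      level zero    = zero
      level (suc i) = level i + 2 * p (approximation i)

      -- Q exceeds twice the previous p, so by not-too-good no numerator p occurs twice.
      approximation : ∀ i → GoodApproximation (suc (level i))
      approximation i = dirichlet (suc (level i))

    level-mono : ∀ {i j} → i ≤′ j → level i ≤ level j
    level-mono ≤′-refl      = ≤-refl
    level-mono (≤′-step i≤j) = ≤-trans (level-mono i≤j) (m≤m+n _ _)

    p-injective : ∀ {i j} → i < j → p (approximation i) ≢ p (approximation j)
    p-injective {i} {j} i<j pᵢ≡pⱼ = not-too-good (approximation j) (s≤s (begin
      2 * p (approximation j) ≡⟨ cong (2 *_) pᵢ≡pⱼ ⟨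
      2 * p (approximation i) ≤⟨ m≤n+m _ (level i) ⟩
      level (suc i)           ≤⟨ level-mono (≤⇒≤′ i<j) ⟩
      level j                 ∎))
      where open ≤-Reasoning

    instance
      K≢0 : NonZero K
      K≢0 = M !≢0

    record Similar {Q Q′} (g : GoodApproximation Q) (g′ : GoodApproximation Q′) : Set where
      field
        p²∸q²D≡ : p g * p g ∸ q g * q g * D ≡ p g′ * p g′ ∸ q g′ * q g′ * D
        q²D∸p²≡ : q g * q g * D ∸ p g * p g ≡ q g′ * q g′ * D ∸ p g′ * p g′
        p%K≡    : p g % K ≡ p g′ % K
        q%K≡    : q g % K ≡ q g′ % K

    C : ℕ
    C = (suc M * suc M) * (K * K)

    opaque
      class : ℕ → Fin C
      class i = combine (combine (fromℕ< (s≤s p²∸q²D≤M)) (fromℕ< (s≤s q²D∸p²≤M)))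
                        (combine (fromℕ< (m%n<n (p g) K)) (fromℕ< (m%n<n (q g) K)))
        where
        g : GoodApproximation (suc (level i))
        g = approximation i
        p²∸q²D≤M : p g * p g ∸ q g * q g * D ≤ M
        p²∸q²D≤M = ≤-trans (m∸n≤∣m-n∣ (p g * p g) (q g * q g * D)) (∣p²-q²D∣≤M g)
        q²D∸p²≤M : q g * q g * D ∸ p g * p g ≤ M
        q²D∸p²≤M = ≤-trans (m∸n≤∣m-n∣ (q g * q g * D) (p g * p g))
                           (subst (_≤ M) (∣-∣-comm (p g * p g) (q g * q g * D)) (∣p²-q²D∣≤M g))

      class-similar : ∀ i j → class i ≡ class j → Similar (approximation i) (approximation j)
      class-similar i j same =
        let e₁₂ , pq = combine-injective {m = suc M * suc M} {n = K * K} same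
            e₁ , e₂ = combine-injective {m = suc M} {n = suc M} e₁₂
            ep , eq = combine-injective {m = K} {n = K} pq
        in record
          { p²∸q²D≡ = fromℕ<-injective (p g * p g ∸ q g * q g * D) (p g′ * p g′ ∸ q g′ * q g′ * D) _ _ e₁
          ; q²D∸p²≡ = fromℕ<-injective (q g * q g * D ∸ p g * p g) (q g′ * q g′ * D ∸ p g′ * p g′) _ _ e₂
          ; p%K≡    = fromℕ<-injective (p g % K) (p g′ % K) _ _ ep
          ; q%K≡    = fromℕ<-injective (q g % K) (q g′ % K) _ _ eq }
        where
        g : GoodApproximation (suc (level i))
        g = approximation i
        g′ : GoodApproximation (suc (level j))
        g′ = approximation j

    similar⇒pell : ∀ {i j} → i < j → Similar (approximation i) (approximation j) → PellSolution (+ D)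
    similar⇒pell {i} {j} i<j similar = congruent-same-norm⇒pell (+ D) (norm g) (+ p g) (+ q g) (+ p g′) (+ q g′)
      (norm≢0 g) (pos-norm D (p g) (q g)) (trans (pos-norm D (p g′) (q g′)) (sym same-norm))
      (ℤ.∣-trans (norm∣K g) (%-equal⇒∣- (p g) (p g′) K p%K≡))
      (ℤ.∣-trans (norm∣K g) (%-equal⇒∣- (q g) (q g′) K q%K≡))
      not-proportional
      where
      open Similar similar
      g : GoodApproximation (suc (level i))
      g = approximation i
      g′ : GoodApproximation (suc (level j))
      g′ = approximation j
      same-norm : norm g ≡ norm g′
      same-norm = begin
        norm g
          ≡⟨ m⊖n≡[m∸n]⊖[n∸m] (p g * p g) (q g * q g * D) ⟩
        (p g * p g ∸ q g * q g * D) ⊖ (q g * q g * D ∸ p g * p g)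
          ≡⟨ cong₂ _⊖_ p²∸q²D≡ q²D∸p²≡ ⟩
        (p g′ * p g′ ∸ q g′ * q g′ * D) ⊖ (q g′ * q g′ * D ∸ p g′ * p g′)
          ≡⟨ m⊖n≡[m∸n]⊖[n∸m] (p g′ * p g′) (q g′ * q g′ * D) ⟨
        norm g′ ∎
        where open ≡-Reasoning
      not-proportional : + p g ℤ.* + q g′ ℤ.- + q g ℤ.* + p g′ ≢ ℤ.0ℤ
      not-proportional Y≡0 =
        p-injective i<j (same-norm-proportional⇒≡ D {p g} {q g} {p g′} {q g′} (1≤q g′) (norm≢0 g) same-norm Y≡0)

    opaque
      pell : PellSolution (+ D)
      pell = let i , j , i<j , same = pigeonhole (n<1+n C) (λ i → class (toℕ i))
             in similar⇒pell i<j (class-similar (toℕ i) (toℕ j) same)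

module SquarefreeIrrational where

  open import Data.Nat
  import Data.Nat as ℕ
  open import Data.Nat.Properties
  open import Data.Nat.DivMod using (_/_; m/n*n≡m)
  open import Data.Nat.GCD using (gcd; gcd[m,n]∣m; gcd[m,n]∣n; gcd[m,n]≢0)
  open import Data.Nat.Coprimality as Coprime using (Coprime; coprime-/gcd; coprime-divisor)
  open import Data.Nat.Divisibility using (divides; ∣-refl; ∣-reflexive)
  open import Data.Nat.Tactic.RingSolver using (solve-∀)
  open import Data.Product using (_,_)
  open import Data.Sum using (inj₂)
  open import Relation.Binary.PropositionalEquality

  coprime-square≡square*D : ∀ {p q D} → Coprime p q → p * p ≡ q * q * D → q ≡ 1
  coprime-square≡square*D {p} {q} {D} p⊥q p²≡q²D =
    p⊥q (coprime-divisor (Coprime.sym p⊥q) (divides (q * D) (trans p²≡q²D (rearrange q D))) , ∣-refl)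
    where
    rearrange : ∀ q D → q * q * D ≡ q * D * q
    rearrange = solve-∀

  squarefree⇒nonsquare : ∀ D → Squarefree D → 1 < D → ∀ p q → 1 ≤ q → p * p ≢ q * q * D
  squarefree⇒nonsquare D squarefree 1<D p q 1≤q p²≡q²D = <⇒≢ 1<D (sym D≡1)
    where
    g : ℕ
    g = gcd p q
    instance
      _ : NonZero g
      _ = ≢-nonZero (gcd[m,n]≢0 p q (inj₂ (λ q≡0 → <⇒≢ 1≤q (sym q≡0))))
      _ : NonZero (g * g)
      _ = m*n≢0 g g
    p′ q′ : ℕ
    p′ = p / g
    q′ = q / g
    p′²≡q′²D : p′ * p′ ≡ q′ * q′ * D
    p′²≡q′²D = *-cancelʳ-≡ (p′ * p′) (q′ * q′ * D) (g * g) (begin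
      (p′ * p′) * (g * g)       ≡⟨ factor p′ g ⟩
      (p′ * g) * (p′ * g)       ≡⟨ cong (λ x → x * x) (m/n*n≡m (gcd[m,n]∣m p q)) ⟩
      p * p                     ≡⟨ p²≡q²D ⟩
      q * q * D                 ≡⟨ cong (λ x → x * x * D) (m/n*n≡m (gcd[m,n]∣n p q)) ⟨
      (q′ * g) * (q′ * g) * D   ≡⟨ factor-D q′ g D ⟩
      (q′ * q′ * D) * (g * g)   ∎)
      where
      open ≡-Reasoning
      factor : ∀ x g → (x * x) * (g * g) ≡ (x * g) * (x * g)
      factor = solve-∀
      factor-D : ∀ x g D → (x * g) * (x * g) * D ≡ (x * x * D) * (g * g)
      factor-D = solve-∀
    q′≡1 : q′ ≡ 1
    q′≡1 = coprime-square≡square*D (coprime-/gcd p q) p′²≡q′²D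
    p′²≡D : p′ * p′ ≡ D
    p′²≡D = trans p′²≡q′²D (trans (cong (λ x → x * x * D) q′≡1) (*-identityˡ D))
    D≡1 : D ≡ 1
    D≡1 = trans (sym p′²≡D) (cong (λ x → x * x) (squarefree p′ (∣-reflexive p′²≡D)))

module CongruentPell where

  open import Data.Nat as ℕ using (ℕ; zero; suc; s≤s; z≤n)
  open import Relation.Binary.PropositionalEquality
  open import Data.Integer
  open import Data.Integer.Properties
  open import Data.Integer.Divisibility.Signed using (_∣_; divides)
  open import Data.Integer.Tactic.RingSolver using (solve-∀)
  open import Data.Product using (Σ; _,_)
  open import Data.Sum using (inj₁; inj₂)
  open import Data.Nat.Properties as ℕ using (*-mono-≤)
  open import Data.Nat.Tactic.RingSolver as ℕ using ()
  open PellSolutions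
  open PellEquation using (module Pell)
  open SquarefreeIrrational using (squarefree⇒nonsquare)

  *-≢0 : ∀ {i j} → i ≢ 0ℤ → j ≢ 0ℤ → i * j ≢ 0ℤ
  *-≢0 {i} i≢0 j≢0 ij≡0 with i*j≡0⇒i≡0∨j≡0 i ij≡0
  ... | inj₁ i≡0 = i≢0 i≡0
  ... | inj₂ j≡0 = j≢0 j≡0

  square-pos : ∀ i → i * i ≡ + (∣ i ∣ ℕ.* ∣ i ∣)
  square-pos (+ n)    = sym (pos-* n n)
  square-pos -[1+ n ] = refl

  0-[+m]≢1 : ∀ m → 0ℤ - + m ≢ 1ℤ
  0-[+m]≢1 zero    ()
  0-[+m]≢1 (suc m) ()

  pell-u≢0 : ∀ {d u v} → u * u - + d * (v * v) ≡ 1ℤ → u ≢ 0ℤ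
  pell-u≢0 {d} {u} {v} pell refl = 0-[+m]≢1 (d ℕ.* (∣ v ∣ ℕ.* ∣ v ∣)) (begin
    0ℤ - + (d ℕ.* (∣ v ∣ ℕ.* ∣ v ∣)) ≡⟨ cong (λ x → 0ℤ - x) (pos-* d _) ⟩
    0ℤ - + d * + (∣ v ∣ ℕ.* ∣ v ∣)  ≡⟨ cong (λ x → 0ℤ - + d * x) (square-pos v) ⟨
    0ℤ - + d * (v * v)              ≡⟨ pell ⟩
    1ℤ                              ∎)
    where open ≡-Reasoning

  -- (u + v N √D)² = u² + D N² v² + 2 u v N √D, and u² + D N² v² = 1 + 2 D N² v².
  square-pell-solution : ∀ d N → N ≢ 0ℤ → PellSolution (+ d * (N * N)) →
                       Σ (PellSolution (+ d)) λ sol → N ∣ PellSolution.u sol - 1ℤ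
  square-pell-solution d N N≢0 record { u = u ; v = v ; v≢0 = v≢0 ; u²-Dv²≡1 = pell } =
    record { u = U ; v = V ; v≢0 = V≢0 ; u²-Dv²≡1 = trans (square-norm u v (+ d) N) (cong (λ x → x * x) pell) }
    , divides (+ 2 * + d * N * (v * v)) (begin
        U - 1ℤ                                              ≡⟨ U-1 u v (+ d) N ⟩
        (u * u - + d * (N * N) * (v * v)) - 1ℤ + + 2 * + d * N * (v * v) * N
                                                            ≡⟨ cong (λ x → x - 1ℤ + + 2 * + d * N * (v * v) * N) pell ⟩
        1ℤ - 1ℤ + + 2 * + d * N * (v * v) * N               ≡⟨ +-identityˡ _ ⟩
        + 2 * + d * N * (v * v) * N                         ∎)
    where
    open ≡-Reasoning
    U V : ℤ
    U = u * u + + d * (N * N) * (v * v)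
    V = + 2 * u * N * v
    square-norm : ∀ u v d N →
      (u * u + d * (N * N) * (v * v)) * (u * u + d * (N * N) * (v * v)) - d * ((+ 2 * u * N * v) * (+ 2 * u * N * v))
        ≡ (u * u - d * (N * N) * (v * v)) * (u * u - d * (N * N) * (v * v))
    square-norm = solve-∀
    U-1 : ∀ u v d N → (u * u + d * (N * N) * (v * v)) - 1ℤ ≡ (u * u - d * (N * N) * (v * v)) - 1ℤ + + 2 * d * N * (v * v) * N
    U-1 = solve-∀
    V≢0 : V ≢ 0ℤ
    V≢0 = *-≢0 {+ 2 * u * N} {v} (*-≢0 {+ 2 * u} {N} (*-≢0 {+ 2} {u} (λ ()) u≢0) N≢0) v≢0
      where
      u≢0 : u ≢ 0ℤ
      u≢0 = pell-u≢0 {d ℕ.* (∣ N ∣ ℕ.* ∣ N ∣)} {u} {v} (subst (λ x → u * u - x * (v * v) ≡ 1ℤ)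
                             (trans (cong (λ x → + d * x) (square-pos N)) (sym (pos-* d (∣ N ∣ ℕ.* ∣ N ∣)))) pell)

  opaque
    pell-solution-≡1-mod : ∀ D → 1 ℕ.< D → Squarefree D → ∀ N → 1 ℕ.≤ N →
                  Σ (PellSolution (+ D)) λ sol → + N ∣ PellSolution.u sol - 1ℤ
    pell-solution-≡1-mod D 1<D squarefree N@(suc _) _ =
      square-pell-solution D (+ N) (λ ())
        (subst PellSolution (trans (pos-* D (N ℕ.* N)) (cong (λ x → + D * x) (pos-* N N)))
          (Pell.pell (D ℕ.* (N ℕ.* N)) nonsquare))
      where
      nonsquare : ∀ p q → 1 ℕ.≤ q → p ℕ.* p ≢ q ℕ.* q ℕ.* (D ℕ.* (N ℕ.* N))
      nonsquare p q 1≤q p²≡q²DN² = squarefree⇒nonsquare D squarefree 1<D p (q ℕ.* N) (ℕ.*-mono-≤ 1≤q (ℕ.s≤s ℕ.z≤n))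
        (trans p²≡q²DN² (rearrange q N D))
        where
        rearrange : ∀ q N D → q ℕ.* q ℕ.* (D ℕ.* (N ℕ.* N)) ≡ q ℕ.* N ℕ.* (q ℕ.* N) ℕ.* D
        rearrange = ℕ.solve-∀

module RationalEmbedding where

  open import Data.Integer as ℤ using (ℤ)
  import Data.Integer.Properties as ℤ
  open import Data.Rational as ℚ using (ℚ)
  import Data.Rational.Properties as ℚ
  open import Data.Rational.Unnormalised as ℚᵘ using (ℚᵘ; mkℚᵘ; *≡*)
  import Data.Rational.Unnormalised.Properties as ℚᵘ
  open import Relation.Binary.PropositionalEquality

  -- ℤ→ℚ z is definitionally fromℚᵘ (z / 1), so its properties are transported from ℚᵘ.
  toℚᵘ-ℤ→ℚ : ∀ z → ℚ.toℚᵘ (ℤ→ℚ z) ℚᵘ.≃ mkℚᵘ z 0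
  toℚᵘ-ℤ→ℚ z = ℚ.toℚᵘ-fromℚᵘ (mkℚᵘ z 0)

  ℤ→ℚ-+ : ∀ a b → ℤ→ℚ (a ℤ.+ b) ≡ ℤ→ℚ a ℚ.+ ℤ→ℚ b
  ℤ→ℚ-+ a b = ℚ.toℚᵘ-injective (ℚᵘ.≃-trans (toℚᵘ-ℤ→ℚ (a ℤ.+ b)) (ℚᵘ.≃-trans (*≡* eq) (ℚᵘ.≃-sym
    (ℚᵘ.≃-trans (ℚ.toℚᵘ-homo-+ (ℤ→ℚ a) (ℤ→ℚ b)) (ℚᵘ.+-cong (toℚᵘ-ℤ→ℚ a) (toℚᵘ-ℤ→ℚ b))))))
    where
    eq : (a ℤ.+ b) ℤ.* ℤ.+ 1 ≡ (a ℤ.* ℤ.+ 1 ℤ.+ b ℤ.* ℤ.+ 1) ℤ.* ℤ.+ 1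
    eq = cong (ℤ._* ℤ.+ 1) (cong₂ ℤ._+_ (sym (ℤ.*-identityʳ a)) (sym (ℤ.*-identityʳ b)))

  ℤ→ℚ-* : ∀ a b → ℤ→ℚ (a ℤ.* b) ≡ ℤ→ℚ a ℚ.* ℤ→ℚ b
  ℤ→ℚ-* a b = ℚ.toℚᵘ-injective (ℚᵘ.≃-trans (toℚᵘ-ℤ→ℚ (a ℤ.* b)) (ℚᵘ.≃-trans (*≡* refl) (ℚᵘ.≃-sym
    (ℚᵘ.≃-trans (ℚ.toℚᵘ-homo-* (ℤ→ℚ a) (ℤ→ℚ b)) (ℚᵘ.*-cong (toℚᵘ-ℤ→ℚ a) (toℚᵘ-ℤ→ℚ b))))))

  ℤ→ℚ-neg : ∀ a → ℤ→ℚ (ℤ.- a) ≡ ℚ.- ℤ→ℚ a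
  ℤ→ℚ-neg a = ℚ.toℚᵘ-injective (ℚᵘ.≃-trans (toℚᵘ-ℤ→ℚ (ℤ.- a))
    (ℚᵘ.≃-sym (ℚᵘ.≃-trans (ℚ.toℚᵘ-homo‿- (ℤ→ℚ a)) (ℚᵘ.-‿cong (toℚᵘ-ℤ→ℚ a)))))

  ℤ→ℚ-sub : ∀ a b → ℤ→ℚ (a ℤ.- b) ≡ ℤ→ℚ a ℚ.- ℤ→ℚ b
  ℤ→ℚ-sub a b = trans (ℤ→ℚ-+ a (ℤ.- b)) (cong (ℤ→ℚ a ℚ.+_) (ℤ→ℚ-neg b))

  ℤ→ℚ-injective : ∀ {a b} → ℤ→ℚ a ≡ ℤ→ℚ b → a ≡ b
  ℤ→ℚ-injective {a} {b} eq
    with ℚᵘ.≃-trans (ℚᵘ.≃-sym (toℚᵘ-ℤ→ℚ a)) (ℚᵘ.≃-trans (ℚᵘ.≃-reflexive (cong ℚ.toℚᵘ eq)) (toℚᵘ-ℤ→ℚ b))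
  ... | *≡* a*1≡b*1 = trans (sym (ℤ.*-identityʳ a)) (trans a*1≡b*1 (ℤ.*-identityʳ b))

  ℤ→ℚ-+* : ∀ a b c → ℤ→ℚ (a ℤ.+ b ℤ.* c) ≡ ℤ→ℚ a ℚ.+ ℤ→ℚ b ℚ.* ℤ→ℚ c
  ℤ→ℚ-+* a b c = trans (ℤ→ℚ-+ a (b ℤ.* c)) (cong (ℤ→ℚ a ℚ.+_) (ℤ→ℚ-* b c))

module QuadraticFieldAlgebra where

  open import Data.Nat as ℕ using (ℕ)
  import Data.Nat.Properties as ℕ
  open import Data.Integer as ℤ using (ℤ; +_)
  import Data.Integer.Properties as ℤ
  open import Data.Rational using (ℚ; 0ℚ; 1ℚ; _+_; _*_; _-_; -_)
  import Data.Rational.Properties as ℚ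
  open import Data.Rational.Solver using (module +-*-Solver)
  open import Data.Product using (_,_; _×_; ∃₂; proj₁; proj₂)
  open import Data.List using ([]; _∷_)
  open import Data.Sum using (_⊎_; inj₁; inj₂)
  open import Relation.Binary.PropositionalEquality
  open RationalEmbedding
  open +-*-Solver using (solve; _:=_; _:+_; _:*_; _:-_; :-_; con)

  i*j≡1⇒i≡±1 : ∀ i j → i ℤ.* j ≡ + 1 → i ≡ + 1 ⊎ i ≡ ℤ.- (+ 1)
  i*j≡1⇒i≡±1 i j ij≡1 with ℕ.m*n≡1⇒m≡1 ℤ.∣ i ∣ ℤ.∣ j ∣ (trans (sym (ℤ.abs-* i j)) (cong ℤ.∣_∣ ij≡1))
  i*j≡1⇒i≡±1 (+ .1)      j ij≡1 | refl = inj₁ refl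
  i*j≡1⇒i≡±1 ℤ.-[1+ .0 ] j ij≡1 | refl = inj₂ refl

  1ℚ+x≡0ℚ⇒x≡-1ℚ : ∀ {x} → 1ℚ + x ≡ 0ℚ → x ≡ - 1ℚ
  1ℚ+x≡0ℚ⇒x≡-1ℚ {x} 1+x≡0 = begin
    x                  ≡⟨ solve 1 (λ x → x := (con 1ℚ :+ x) :+ :- con 1ℚ) refl x ⟩
    (1ℚ + x) + - 1ℚ    ≡⟨ cong (_+ - 1ℚ) 1+x≡0 ⟩
    0ℚ + - 1ℚ          ≡⟨ ℚ.+-identityˡ (- 1ℚ) ⟩
    - 1ℚ               ∎
    where open ≡-Reasoning

  module QuadraticField (D : ℕ) where

    δ : ℚ
    δ = ℤ→ℚ (+ D)

    infixl 30 _·_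
    _·_ : E → E → E
    _·_ = mulE D

    ·-distribˡ-+E : ∀ x y z → x · (y +E z) ≡ x · y +E x · z
    ·-distribˡ-+E (x₁ , x₂) (y₁ , y₂) (z₁ , z₂) = cong₂ _,_
      (solve 7 (λ x₁ x₂ y₁ y₂ z₁ z₂ d → x₁ :* (y₁ :+ z₁) :+ d :* x₂ :* (y₂ :+ z₂)
                                        := (x₁ :* y₁ :+ d :* x₂ :* y₂) :+ (x₁ :* z₁ :+ d :* x₂ :* z₂))
         refl x₁ x₂ y₁ y₂ z₁ z₂ δ)
      (solve 6 (λ x₁ x₂ y₁ y₂ z₁ z₂ → x₁ :* (y₂ :+ z₂) :+ x₂ :* (y₁ :+ z₁)
                                      := (x₁ :* y₂ :+ x₂ :* y₁) :+ (x₁ :* z₂ :+ x₂ :* z₁))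
         refl x₁ x₂ y₁ y₂ z₁ z₂)

    ·-interchange : ∀ x y z w → (x · y) · (z · w) ≡ (x · z) · (y · w)
    ·-interchange (x₁ , x₂) (y₁ , y₂) (z₁ , z₂) (w₁ , w₂) = cong₂ _,_
      (solve 9 (λ x₁ x₂ y₁ y₂ z₁ z₂ w₁ w₂ d →
           (x₁ :* y₁ :+ d :* x₂ :* y₂) :* (z₁ :* w₁ :+ d :* z₂ :* w₂) :+ d :* (x₁ :* y₂ :+ x₂ :* y₁) :* (z₁ :* w₂ :+ z₂ :* w₁)
        := (x₁ :* z₁ :+ d :* x₂ :* z₂) :* (y₁ :* w₁ :+ d :* y₂ :* w₂) :+ d :* (x₁ :* z₂ :+ x₂ :* z₁) :* (y₁ :* w₂ :+ y₂ :* w₁))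
        refl x₁ x₂ y₁ y₂ z₁ z₂ w₁ w₂ δ)
      (solve 9 (λ x₁ x₂ y₁ y₂ z₁ z₂ w₁ w₂ d →
           (x₁ :* y₁ :+ d :* x₂ :* y₂) :* (z₁ :* w₂ :+ z₂ :* w₁) :+ (x₁ :* y₂ :+ x₂ :* y₁) :* (z₁ :* w₁ :+ d :* z₂ :* w₂)
        := (x₁ :* z₁ :+ d :* x₂ :* z₂) :* (y₁ :* w₂ :+ y₂ :* w₁) :+ (x₁ :* z₂ :+ x₂ :* z₁) :* (y₁ :* w₁ :+ d :* y₂ :* w₂))
        refl x₁ x₂ y₁ y₂ z₁ z₂ w₁ w₂ δ)

    ·-zeroʳ : ∀ x → x · 0E ≡ 0E
    ·-zeroʳ (x₁ , x₂) = cong₂ _,_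
      (solve 3 (λ x₁ x₂ d → x₁ :* con 0ℚ :+ d :* x₂ :* con 0ℚ := con 0ℚ) refl x₁ x₂ δ)
      (solve 2 (λ x₁ x₂ → x₁ :* con 0ℚ :+ x₂ :* con 0ℚ := con 0ℚ) refl x₁ x₂)

    1E+x≡0E⇒x≡-1 : ∀ {x} → 1E +E x ≡ 0E → x ≡ (- 1ℚ , 0ℚ)
    1E+x≡0E⇒x≡-1 {x₁ , x₂} 1+x≡0 = cong₂ _,_
      (1ℚ+x≡0ℚ⇒x≡-1ℚ (cong proj₁ 1+x≡0))
      (trans (sym (ℚ.+-identityˡ x₂)) (cong proj₂ 1+x≡0))

    normE-[-1] : normE D (- 1ℚ , 0ℚ) ≡ 1ℚ
    normE-[-1] = solve 1 (λ d → (:- con 1ℚ) :* (:- con 1ℚ) :- d :* con 0ℚ :* con 0ℚ := con 1ℚ) refl δ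

    normE-· : ∀ x y → normE D (x · y) ≡ normE D x * normE D y
    normE-· (x₁ , x₂) (y₁ , y₂) = solve 5 (λ x₁ x₂ y₁ y₂ d →
           (x₁ :* y₁ :+ d :* x₂ :* y₂) :* (x₁ :* y₁ :+ d :* x₂ :* y₂) :- d :* (x₁ :* y₂ :+ x₂ :* y₁) :* (x₁ :* y₂ :+ x₂ :* y₁)
        := (x₁ :* x₁ :- d :* x₂ :* x₂) :* (y₁ :* y₁ :- d :* y₂ :* y₂))
        refl x₁ x₂ y₁ y₂ δ

    charPoly-root : ∀ {η t n} → CharPoly D η t n → evalMonic D (n ∷ ℤ.- t ∷ []) η ≡ 0E
    charPoly-root {P , R} {t} {n} (tr , nm) rewrite ℤ→ℚ-neg t | sym tr | sym nm = cong₂ _,_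
      (solve 3 (λ P R d → (P :* P :- d :* R :* R) :+ (P :* (:- (P :+ P) :+ (P :* con 1ℚ :+ d :* R :* con 0ℚ))
                            :+ d :* R :* (con 0ℚ :+ (P :* con 0ℚ :+ R :* con 1ℚ))) := con 0ℚ) refl P R δ)
      (solve 3 (λ P R d → con 0ℚ :+ (P :* (con 0ℚ :+ (P :* con 0ℚ :+ R :* con 1ℚ))
                            :+ R :* (:- (P :+ P) :+ (P :* con 1ℚ :+ d :* R :* con 0ℚ))) := con 0ℚ) refl P R δ)

    charPoly-integral : ∀ {η t n} → CharPoly D η t n → InO D η
    charPoly-integral {η} {t} {n} cp = (n ∷ ℤ.- t ∷ []) , charPoly-root {η} {t} {n} cp

    reversed-polynomial-step : ∀ η μ w e c S → η · μ ≡ 1E → w · e ≡ 1E +E η · S →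
                (η · w) · (ιℤ c +E μ · e) ≡ 1E +E η · (ιℤ c · w +E S)
    reversed-polynomial-step η μ w e c S ημ≡1 we≡1+ηS = begin
      (η · w) · (ιℤ c +E μ · e)                ≡⟨ ·-distribˡ-+E (η · w) (ιℤ c) (μ · e) ⟩
      (η · w) · ιℤ c +E (η · w) · (μ · e)      ≡⟨ cong ((η · w) · ιℤ c +E_) (·-interchange η w μ e) ⟩
      (η · w) · ιℤ c +E (η · μ) · (w · e)      ≡⟨ cong₂ (λ x y → (η · w) · ιℤ c +E x · y) ημ≡1 we≡1+ηS ⟩
      (η · w) · ιℤ c +E 1E · (1E +E η · S)     ≡⟨ regroup η w S (ℤ→ℚ c) ⟩
      1E +E η · (ιℤ c · w +E S)                ∎
      where
      open ≡-Reasoning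
      regroup : ∀ η w S C → (η · w) · ι C +E 1E · (1E +E η · S) ≡ 1E +E η · (ι C · w +E S)
      regroup (h₁ , h₂) (w₁ , w₂) (s₁ , s₂) C = cong₂ _,_
        (solve 8 (λ h₁ h₂ w₁ w₂ s₁ s₂ C d →
             ((h₁ :* w₁ :+ d :* h₂ :* w₂) :* C :+ d :* (h₁ :* w₂ :+ h₂ :* w₁) :* con 0ℚ)
             :+ (con 1ℚ :* (con 1ℚ :+ (h₁ :* s₁ :+ d :* h₂ :* s₂)) :+ d :* con 0ℚ :* (con 0ℚ :+ (h₁ :* s₂ :+ h₂ :* s₁)))
          := con 1ℚ :+ (h₁ :* ((C :* w₁ :+ d :* con 0ℚ :* w₂) :+ s₁) :+ d :* h₂ :* ((C :* w₂ :+ con 0ℚ :* w₁) :+ s₂)))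
          refl h₁ h₂ w₁ w₂ s₁ s₂ C δ)
        (solve 8 (λ h₁ h₂ w₁ w₂ s₁ s₂ C d →
             ((h₁ :* w₁ :+ d :* h₂ :* w₂) :* con 0ℚ :+ (h₁ :* w₂ :+ h₂ :* w₁) :* C)
             :+ (con 1ℚ :* (con 0ℚ :+ (h₁ :* s₂ :+ h₂ :* s₁)) :+ con 0ℚ :* (con 1ℚ :+ (h₁ :* s₁ :+ d :* h₂ :* s₂)))
          := con 0ℚ :+ (h₁ :* ((C :* w₂ :+ con 0ℚ :* w₁) :+ s₂) :+ h₂ :* ((C :* w₁ :+ d :* con 0ℚ :* w₂) :+ s₁)))
          refl h₁ h₂ w₁ w₂ s₁ s₂ C δ)

    -- ⟦ u , v ⟧ = u + v η ∈ ℤ[η], where η has characteristic polynomial x² - t x + n.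
    module IntegralOrder {P R : ℚ} {t n : ℤ} (tr : P + P ≡ ℤ→ℚ t) (nm : P * P - δ * R * R ≡ ℤ→ℚ n) where

      η : E
      η = P , R

      ⟦_⟧ : ℤ × ℤ → E
      ⟦ u , v ⟧ = ℤ→ℚ u + ℤ→ℚ v * P , ℤ→ℚ v * R

      η·⟦⟧ : ∀ u v → η · ⟦ u , v ⟧ ≡ ⟦ ℤ.- (n ℤ.* v) , u ℤ.+ t ℤ.* v ⟧
      η·⟦⟧ u v = cong₂ _,_
        (begin
          P * (U + V * P) + δ * R * (V * R)          ≡⟨ solve 5 (λ P R U V d → P :* (U :+ V :* P) :+ d :* R :* (V :* R)
                                                          := :- ((P :* P :- d :* R :* R) :* V) :+ (U :+ (P :+ P) :* V) :* P)
                                                          refl P R U V δ ⟩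
          - ((P * P - δ * R * R) * V) + (U + (P + P) * V) * P ≡⟨ cong₂ (λ x y → - (x * V) + (U + y * V) * P) nm tr ⟩
          - (ℤ→ℚ n * V) + (U + ℤ→ℚ t * V) * P        ≡⟨ cong₂ (λ x y → x + y * P) (ℤ→ℚ-neg∘* n v) (ℤ→ℚ-+* u t v) ⟨
          ℤ→ℚ (ℤ.- (n ℤ.* v)) + ℤ→ℚ (u ℤ.+ t ℤ.* v) * P ∎)
        (begin
          P * (V * R) + R * (U + V * P)              ≡⟨ solve 4 (λ P R U V → P :* (V :* R) :+ R :* (U :+ V :* P)
                                                          := (U :+ (P :+ P) :* V) :* R) refl P R U V ⟩
          (U + (P + P) * V) * R                      ≡⟨ cong (λ y → (U + y * V) * R) tr ⟩
          (U + ℤ→ℚ t * V) * R                        ≡⟨ cong (_* R) (ℤ→ℚ-+* u t v) ⟨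
          ℤ→ℚ (u ℤ.+ t ℤ.* v) * R                    ∎)
        where
        open ≡-Reasoning
        U V : ℚ
        U = ℤ→ℚ u
        V = ℤ→ℚ v
        ℤ→ℚ-neg∘* : ∀ a b → ℤ→ℚ (ℤ.- (a ℤ.* b)) ≡ - (ℤ→ℚ a * ℤ→ℚ b)
        ℤ→ℚ-neg∘* a b = trans (ℤ→ℚ-neg (a ℤ.* b)) (cong -_ (ℤ→ℚ-* a b))

      ⟦⟧-affine : ∀ c a b u v → ⟦ c ℤ.* a ℤ.+ u , c ℤ.* b ℤ.+ v ⟧ ≡ ιℤ c · ⟦ a , b ⟧ +E ⟦ u , v ⟧
      ⟦⟧-affine c a b u v = cong₂ _,_
        (trans (cong₂ (λ x y → x + y * P) (ℤ→ℚ-*+ c a u) (ℤ→ℚ-*+ c b v))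
          (solve 8 (λ P R C A B U V d → (C :* A :+ U) :+ (C :* B :+ V) :* P
                                        := (C :* (A :+ B :* P) :+ d :* con 0ℚ :* (B :* R)) :+ (U :+ V :* P))
             refl P R (ℤ→ℚ c) (ℤ→ℚ a) (ℤ→ℚ b) (ℤ→ℚ u) (ℤ→ℚ v) δ))
        (trans (cong (_* R) (ℤ→ℚ-*+ c b v))
          (solve 7 (λ P R C A B U V → (C :* B :+ V) :* R
                                      := (C :* (B :* R) :+ con 0ℚ :* (A :+ B :* P)) :+ V :* R)
             refl P R (ℤ→ℚ c) (ℤ→ℚ a) (ℤ→ℚ b) (ℤ→ℚ u) (ℤ→ℚ v)))
        where
        ℤ→ℚ-*+ : ∀ c x y → ℤ→ℚ (c ℤ.* x ℤ.+ y) ≡ ℤ→ℚ c * ℤ→ℚ x + ℤ→ℚ y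
        ℤ→ℚ-*+ c x y = trans (ℤ→ℚ-+ (c ℤ.* x) y) (cong (_+ ℤ→ℚ y) (ℤ→ℚ-* c x))

      normE-⟦⟧ : ∀ u v → normE D ⟦ u , v ⟧ ≡ ℤ→ℚ (u ℤ.* u ℤ.+ u ℤ.* v ℤ.* t ℤ.+ v ℤ.* v ℤ.* n)
      normE-⟦⟧ u v = begin
        (U + V * P) * (U + V * P) - δ * (V * R) * (V * R)
          ≡⟨ solve 5 (λ P R U V d → (U :+ V :* P) :* (U :+ V :* P) :- d :* (V :* R) :* (V :* R)
                                    := U :* U :+ U :* V :* (P :+ P) :+ V :* V :* (P :* P :- d :* R :* R))
               refl P R U V δ ⟩
        U * U + U * V * (P + P) + V * V * (P * P - δ * R * R)
          ≡⟨ cong₂ (λ x y → U * U + U * V * x + V * V * y) tr nm ⟩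
        U * U + U * V * ℤ→ℚ t + V * V * ℤ→ℚ n
          ≡⟨ cong₂ _+_ (cong₂ _+_ (ℤ→ℚ-* u u) (trans (ℤ→ℚ-* (u ℤ.* v) t) (cong (_* ℤ→ℚ t) (ℤ→ℚ-* u v))))
                       (trans (ℤ→ℚ-* (v ℤ.* v) n) (cong (_* ℤ→ℚ n) (ℤ→ℚ-* v v))) ⟨
        ℤ→ℚ (u ℤ.* u) + ℤ→ℚ (u ℤ.* v ℤ.* t) + ℤ→ℚ (v ℤ.* v ℤ.* n)
          ≡⟨ cong (_+ ℤ→ℚ (v ℤ.* v ℤ.* n)) (ℤ→ℚ-+ (u ℤ.* u) (u ℤ.* v ℤ.* t)) ⟨
        ℤ→ℚ (u ℤ.* u ℤ.+ u ℤ.* v ℤ.* t) + ℤ→ℚ (v ℤ.* v ℤ.* n)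
          ≡⟨ ℤ→ℚ-+ (u ℤ.* u ℤ.+ u ℤ.* v ℤ.* t) (v ℤ.* v ℤ.* n) ⟨
        ℤ→ℚ (u ℤ.* u ℤ.+ u ℤ.* v ℤ.* t ℤ.+ v ℤ.* v ℤ.* n) ∎
        where
        open ≡-Reasoning
        U V : ℚ
        U = ℤ→ℚ u
        V = ℤ→ℚ v

      -- For monic f of degree k, η^k f(μ) = 1 + η S with η^k, S ∈ ℤ[η], because η μ = 1.
      reversed-polynomial : ∀ {μ} → η · μ ≡ 1E → ∀ cs → ∃₂ λ w S → ⟦ w ⟧ · evalMonic D cs μ ≡ 1E +E η · ⟦ S ⟧
      reversed-polynomial ημ≡1 [] = (+ 1 , + 0) , (+ 0 , + 0) , cong₂ _,_
        (solve 3 (λ P R d → (con 1ℚ :+ con 0ℚ :* P) :* con 1ℚ :+ d :* (con 0ℚ :* R) :* con 0ℚ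
                            := con 1ℚ :+ (P :* (con 0ℚ :+ con 0ℚ :* P) :+ d :* R :* (con 0ℚ :* R))) refl P R δ)
        (solve 3 (λ P R d → (con 1ℚ :+ con 0ℚ :* P) :* con 0ℚ :+ (con 0ℚ :* R) :* con 1ℚ
                            := con 0ℚ :+ (P :* (con 0ℚ :* R) :+ R :* (con 0ℚ :+ con 0ℚ :* P))) refl P R δ)
      reversed-polynomial {μ} ημ≡1 (c ∷ cs) =
        let (a , b) , (u , v) , ih = reversed-polynomial ημ≡1 cs
        in (ℤ.- (n ℤ.* b) , a ℤ.+ t ℤ.* b) , (c ℤ.* a ℤ.+ u , c ℤ.* b ℤ.+ v) , (begin
          ⟦ ℤ.- (n ℤ.* b) , a ℤ.+ t ℤ.* b ⟧ · (ιℤ c +E μ · evalMonic D cs μ)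
            ≡⟨ cong (_· (ιℤ c +E μ · evalMonic D cs μ)) (η·⟦⟧ a b) ⟨
          (η · ⟦ a , b ⟧) · (ιℤ c +E μ · evalMonic D cs μ)
            ≡⟨ reversed-polynomial-step η μ ⟦ a , b ⟧ (evalMonic D cs μ) c ⟦ u , v ⟧ ημ≡1 ih ⟩
          1E +E η · (ιℤ c · ⟦ a , b ⟧ +E ⟦ u , v ⟧)
            ≡⟨ cong (λ x → 1E +E η · x) (⟦⟧-affine c a b u v) ⟨
          1E +E η · ⟦ c ℤ.* a ℤ.+ u , c ℤ.* b ℤ.+ v ⟧ ∎)
        where open ≡-Reasoning

      norm-±1 : ∀ {μ} → η · μ ≡ 1E → InO D μ → n ≡ + 1 ⊎ n ≡ ℤ.- (+ 1)
      norm-±1 {μ} ημ≡1 (cs , f[μ]≡0) =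
        let w , (u , v) , ih = reversed-polynomial ημ≡1 cs
            ηS≡-1 : η · ⟦ u , v ⟧ ≡ (- 1ℚ , 0ℚ)
            ηS≡-1 = 1E+x≡0E⇒x≡-1 (trans (sym ih) (trans (cong (⟦ w ⟧ ·_) f[μ]≡0) (·-zeroʳ ⟦ w ⟧)))
        in i*j≡1⇒i≡±1 n _ (ℤ→ℚ-injective (begin
             ℤ→ℚ (n ℤ.* (u ℤ.* u ℤ.+ u ℤ.* v ℤ.* t ℤ.+ v ℤ.* v ℤ.* n)) ≡⟨ ℤ→ℚ-* n _ ⟩
             ℤ→ℚ n * ℤ→ℚ (u ℤ.* u ℤ.+ u ℤ.* v ℤ.* t ℤ.+ v ℤ.* v ℤ.* n) ≡⟨ cong₂ _*_ nm (normE-⟦⟧ u v) ⟨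
             normE D η * normE D ⟦ u , v ⟧                             ≡⟨ normE-· η ⟦ u , v ⟧ ⟨
             normE D (η · ⟦ u , v ⟧)                                   ≡⟨ cong (normE D) ηS≡-1 ⟩
             normE D (- 1ℚ , 0ℚ)                                       ≡⟨ normE-[-1] ⟩
             1ℚ                                                        ∎))
        where open ≡-Reasoning

    -- n · η̄ = n (t - η) is the inverse of η when n² = 1.
    module ScaledConjugate {P R : ℚ} {t n : ℤ} (tr : P + P ≡ ℤ→ℚ t) (nm : P * P - δ * R * R ≡ ℤ→ℚ n) where

      μ : E
      μ = ℤ→ℚ n * (ℤ→ℚ t - P) , ℤ→ℚ n * (- R)

      η·μ : (P , R) · μ ≡ (ℤ→ℚ n * ℤ→ℚ n , 0ℚ)
      η·μ rewrite sym tr | sym nm = cong₂ _,_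
        (solve 3 (λ P R d → P :* ((P :* P :- d :* R :* R) :* ((P :+ P) :- P)) :+ d :* R :* ((P :* P :- d :* R :* R) :* (:- R))
                            := (P :* P :- d :* R :* R) :* (P :* P :- d :* R :* R)) refl P R δ)
        (solve 3 (λ P R d → P :* ((P :* P :- d :* R :* R) :* (:- R)) :+ R :* ((P :* P :- d :* R :* R) :* ((P :+ P) :- P))
                            := con 0ℚ) refl P R δ)

      μ-charPoly : CharPoly D μ (n ℤ.* t) (n ℤ.* n ℤ.* n)
      μ-charPoly rewrite ℤ→ℚ-* n t | ℤ→ℚ-* (n ℤ.* n) n | ℤ→ℚ-* n n | sym tr | sym nm =
          solve 3 (λ P R d → (P :* P :- d :* R :* R) :* ((P :+ P) :- P) :+ (P :* P :- d :* R :* R) :* ((P :+ P) :- P)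
                             := (P :* P :- d :* R :* R) :* (P :+ P)) refl P R δ
        , solve 3 (λ P R d → (P :* P :- d :* R :* R) :* ((P :+ P) :- P) :* ((P :* P :- d :* R :* R) :* ((P :+ P) :- P))
                               :- d :* ((P :* P :- d :* R :* R) :* (:- R)) :* ((P :* P :- d :* R :* R) :* (:- R))
                             := (P :* P :- d :* R :* R) :* (P :* P :- d :* R :* R) :* (P :* P :- d :* R :* R)) refl P R δ

    charPoly-unit : ∀ {η t n} → CharPoly D η t n → n ℤ.* n ≡ + 1 → IsUnitO D η
    charPoly-unit {η@(P , R)} {t} {n} cp@(tr , nm) n²≡1 =
        charPoly-integral {η} {t} {n} cp
      , μ , charPoly-integral {μ} {n ℤ.* t} {n} (subst (CharPoly D μ (n ℤ.* t)) n³≡n μ-charPoly)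
      , trans η·μ (cong (_, 0ℚ) (trans (sym (ℤ→ℚ-* n n)) (cong ℤ→ℚ n²≡1)))
      where
      open ScaledConjugate {P} {R} {t} {n} tr nm
      n³≡n : n ℤ.* n ℤ.* n ≡ n
      n³≡n = trans (cong (ℤ._* n) n²≡1) (ℤ.*-identityˡ n)

    unit-norm-±1 : ∀ {η t n} → IsUnitO D η → CharPoly D η t n → n ≡ + 1 ⊎ n ≡ ℤ.- (+ 1)
    unit-norm-±1 {P , R} {t} {n} (_ , μ , μ-integral , ημ≡1) (tr , nm) =
      IntegralOrder.norm-±1 {P} {R} {t} {n} tr nm ημ≡1 μ-integral

    ℤ[√D]-charPoly : ∀ u v → CharPoly D (ℤ→ℚ u , ℤ→ℚ v) (u ℤ.+ u) (u ℤ.* u ℤ.- + D ℤ.* (v ℤ.* v))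
    ℤ[√D]-charPoly u v = sym (ℤ→ℚ-+ u u) , (begin
      ℤ→ℚ u * ℤ→ℚ u - δ * ℤ→ℚ v * ℤ→ℚ v   ≡⟨ cong (λ x → ℤ→ℚ u * ℤ→ℚ u - x) (ℚ.*-assoc δ (ℤ→ℚ v) (ℤ→ℚ v)) ⟩
      ℤ→ℚ u * ℤ→ℚ u - δ * (ℤ→ℚ v * ℤ→ℚ v) ≡⟨ cong₂ (λ x y → x - δ * y) (ℤ→ℚ-* u u) (ℤ→ℚ-* v v) ⟨
      ℤ→ℚ (u ℤ.* u) - δ * ℤ→ℚ (v ℤ.* v)   ≡⟨ cong (λ x → ℤ→ℚ (u ℤ.* u) - x) (ℤ→ℚ-* (+ D) (v ℤ.* v)) ⟨
      ℤ→ℚ (u ℤ.* u) - ℤ→ℚ (+ D ℤ.* (v ℤ.* v)) ≡⟨ ℤ→ℚ-sub (u ℤ.* u) (+ D ℤ.* (v ℤ.* v)) ⟨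
      ℤ→ℚ (u ℤ.* u ℤ.- + D ℤ.* (v ℤ.* v)) ∎)
      where open ≡-Reasoning

    rational-charPoly : ∀ {P t n} → CharPoly D (P , 0ℚ) t n → t ℤ.* t ≡ + 4 ℤ.* n
    rational-charPoly {P} {t} {n} (tr , nm) = ℤ→ℚ-injective (begin
      ℤ→ℚ (t ℤ.* t)                               ≡⟨ ℤ→ℚ-* t t ⟩
      ℤ→ℚ t * ℤ→ℚ t                               ≡⟨ cong₂ _*_ tr tr ⟨
      (P + P) * (P + P)                           ≡⟨ solve 2 (λ P d → (P :+ P) :* (P :+ P)
                                                       := (con 1ℚ :+ con 1ℚ :+ con 1ℚ :+ con 1ℚ) :* (P :* P :- d :* con 0ℚ :* con 0ℚ))
                                                       refl P δ ⟩
      (1ℚ + 1ℚ + 1ℚ + 1ℚ) * (P * P - δ * 0ℚ * 0ℚ) ≡⟨ cong (ℤ→ℚ (+ 4) *_) nm ⟩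
      ℤ→ℚ (+ 4) * ℤ→ℚ n                           ≡⟨ ℤ→ℚ-* (+ 4) n ⟨
      ℤ→ℚ (+ 4 ℤ.* n)                             ∎)
      where open ≡-Reasoning

module MatrixEigenvalues where

  open import Data.Nat as ℕ using (ℕ)
  open import Data.Integer as ℤ using (ℤ; +_)
  open import Data.Rational using (ℚ; 0ℚ; 1ℚ; _+_; _*_; _-_; -_; 1/_)
  import Data.Rational as ℚ using (NonZero; ≢-nonZero)
  import Data.Rational.Properties as ℚ
  open import Data.Rational.Solver using (module +-*-Solver)
  open import Data.Product using (_,_; ∃; proj₁; proj₂)
  open import Relation.Binary.PropositionalEquality
  open import Algebra.Properties.Group ℚ.+-0-group using (x∙y⁻¹≈ε⇒x≈y; x≈y⇒x∙y⁻¹≈ε)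
  open RationalEmbedding
  open QuadraticFieldAlgebra
  open +-*-Solver using (solve; _:=_; _:+_; _:*_; _:-_; :-_; con)

  via-difference : ∀ {x y} e → x - y ≡ e → e ≡ 0ℚ → x ≡ y
  via-difference {x} {y} e x-y≡e e≡0 = x∙y⁻¹≈ε⇒x≈y x y (trans x-y≡e e≡0)

  *-cancelʳ-≢0 : ∀ x {q} → q ≢ 0ℚ → x * q ≡ 0ℚ → x ≡ 0ℚ
  *-cancelʳ-≢0 x {q} q≢0 xq≡0 = begin
    x                  ≡⟨ ℚ.*-identityʳ x ⟨
    x * 1ℚ             ≡⟨ cong (x *_) (ℚ.*-inverseʳ q) ⟨
    x * (q * 1/ q)     ≡⟨ ℚ.*-assoc x q (1/ q) ⟨
    (x * q) * 1/ q     ≡⟨ cong (_* 1/ q) xq≡0 ⟩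
    0ℚ * 1/ q          ≡⟨ ℚ.*-zeroˡ (1/ q) ⟩
    0ℚ                 ∎
    where
    open ≡-Reasoning
    instance
      _ : ℚ.NonZero q
      _ = ℚ.≢-nonZero q≢0

  ℤ→ℚ-det : ∀ a b c d → ℤ→ℚ (a ℤ.* d ℤ.- b ℤ.* c) ≡ ℤ→ℚ a * ℤ→ℚ d - ℤ→ℚ b * ℤ→ℚ c
  ℤ→ℚ-det a b c d = trans (ℤ→ℚ-sub (a ℤ.* d) (b ℤ.* c)) (cong₂ _-_ (ℤ→ℚ-* a d) (ℤ→ℚ-* b c))

  module Eigenvalues (D : ℕ) where
    open QuadraticField D

    module EigenvectorEquation {a b c d : ℤ} {p q : ℚ} (q≢0 : q ≢ 0ℚ)
      (aβ+b≡lβ : ιℤ a · (p , q) +E ιℤ b ≡ (ιℤ c · (p , q) +E ιℤ d) · (p , q)) where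
      open ≡-Reasoning
      A B C Dd L₁ L₂ : ℚ
      A = ℤ→ℚ a
      B = ℤ→ℚ b
      C = ℤ→ℚ c
      Dd = ℤ→ℚ d
      L₁ = C * p + δ * 0ℚ * q + Dd
      L₂ = C * q + 0ℚ * p + 0ℚ

      l : E
      l = ιℤ c · (p , q) +E ιℤ d

      k : A - L₁ - C * p ≡ 0ℚ
      k = *-cancelʳ-≢0 (A - L₁ - C * p) q≢0 (begin
        (A - L₁ - C * p) * q                          ≡⟨ solve 6 (λ A C Dd p q d →
                                                           (A :- (C :* p :+ d :* con 0ℚ :* q :+ Dd) :- C :* p) :* q
                                                        := (A :* q :+ con 0ℚ :* p :+ con 0ℚ)
                                                           :- ((C :* p :+ d :* con 0ℚ :* q :+ Dd) :* q :+ (C :* q :+ con 0ℚ :* p :+ con 0ℚ) :* p))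
                                                        refl A C Dd p q δ ⟩
        (A * q + 0ℚ * p + 0ℚ) - (L₁ * q + L₂ * p)    ≡⟨ x≈y⇒x∙y⁻¹≈ε (cong proj₂ aβ+b≡lβ) ⟩
        0ℚ                                            ∎)
      trace : L₁ + L₁ ≡ ℤ→ℚ (a ℤ.+ d)
      trace = begin
        L₁ + L₁                   ≡⟨ solve 6 (λ A C Dd p q d →
                                         (C :* p :+ d :* con 0ℚ :* q :+ Dd) :+ (C :* p :+ d :* con 0ℚ :* q :+ Dd)
                                      := (A :+ Dd) :- (A :- (C :* p :+ d :* con 0ℚ :* q :+ Dd) :- C :* p))
                                      refl A C Dd p q δ ⟩
        (A + Dd) - (A - L₁ - C * p) ≡⟨ cong (λ x → (A + Dd) - x) k ⟩
        (A + Dd) - 0ℚ             ≡⟨ ℚ.+-identityʳ (A + Dd) ⟩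
        A + Dd                    ≡⟨ ℤ→ℚ-+ a d ⟨
        ℤ→ℚ (a ℤ.+ d)             ∎
      norm : L₁ * L₁ - δ * L₂ * L₂ ≡ ℤ→ℚ (a ℤ.* d ℤ.- b ℤ.* c)
      norm = begin
        L₁ * L₁ - δ * L₂ * L₂
          ≡⟨ solve 7 (λ A B C Dd p q d →
                 (C :* p :+ d :* con 0ℚ :* q :+ Dd) :* (C :* p :+ d :* con 0ℚ :* q :+ Dd)
                   :- d :* (C :* q :+ con 0ℚ :* p :+ con 0ℚ) :* (C :* q :+ con 0ℚ :* p :+ con 0ℚ)
              := (A :* Dd :- B :* C)
                   :+ C :* ((A :* p :+ d :* con 0ℚ :* q :+ B)
                            :- ((C :* p :+ d :* con 0ℚ :* q :+ Dd) :* p :+ d :* (C :* q :+ con 0ℚ :* p :+ con 0ℚ) :* q))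
                   :- (Dd :+ C :* p) :* (A :- (C :* p :+ d :* con 0ℚ :* q :+ Dd) :- C :* p))
               refl A B C Dd p q δ ⟩
        (A * Dd - B * C) + C * ((A * p + δ * 0ℚ * q + B) - (L₁ * p + δ * L₂ * q)) - (Dd + C * p) * (A - L₁ - C * p)
          ≡⟨ cong₂ (λ x y → (A * Dd - B * C) + C * x - (Dd + C * p) * y) (x≈y⇒x∙y⁻¹≈ε (cong proj₁ aβ+b≡lβ)) k ⟩
        (A * Dd - B * C) + C * 0ℚ - (Dd + C * p) * 0ℚ
          ≡⟨ solve 4 (λ x C Dd p → x :+ C :* con 0ℚ :- (Dd :+ C :* p) :* con 0ℚ := x) refl (A * Dd - B * C) C Dd p ⟩
        A * Dd - B * C
          ≡⟨ ℤ→ℚ-det a b c d ⟨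
        ℤ→ℚ (a ℤ.* d ℤ.- b ℤ.* c) ∎

    module FixedPoint {a b c d : ℤ} {P R : ℚ} (c≢0 : c ≢ + 0)
      (tr : P + P ≡ ℤ→ℚ (a ℤ.+ d)) (nm : P * P - δ * R * R ≡ ℤ→ℚ (a ℤ.* d ℤ.- b ℤ.* c)) where
      A B C Dd : ℚ
      A = ℤ→ℚ a
      B = ℤ→ℚ b
      C = ℤ→ℚ c
      Dd = ℤ→ℚ d
      C≢0 : C ≢ 0ℚ
      C≢0 C≡0 = c≢0 (ℤ→ℚ-injective C≡0)
      instance
        _ : ℚ.NonZero C
        _ = ℚ.≢-nonZero C≢0
      w : ℚ
      w = 1/ C
      Cw-1≡0 : C * w - 1ℚ ≡ 0ℚ
      Cw-1≡0 = x≈y⇒x∙y⁻¹≈ε (ℚ.*-inverseʳ C)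
      w≢0 : w ≢ 0ℚ
      w≢0 w≡0 with () ← trans (sym (ℚ.*-inverseʳ C)) (trans (cong (C *_) w≡0) (ℚ.*-zeroʳ C))
      T≡0 : (A + Dd) - (P + P) ≡ 0ℚ
      T≡0 = x≈y⇒x∙y⁻¹≈ε (sym (trans tr (ℤ→ℚ-+ a d)))
      N≡0 : (P * P - δ * R * R) - (A * Dd - B * C) ≡ 0ℚ
      N≡0 = x≈y⇒x∙y⁻¹≈ε (trans nm (ℤ→ℚ-det a b c d))
      β : E
      β = (P - Dd) * w , R * w
      aβ+b≡ηβ₁ : (A * ((P - Dd) * w) + δ * 0ℚ * (R * w)) + B ≡ P * ((P - Dd) * w) + δ * R * (R * w)
      aβ+b≡ηβ₁ = via-difference (w * P * ((A + Dd) - (P + P)) + w * ((P * P - δ * R * R) - (A * Dd - B * C)) - B * (C * w - 1ℚ))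
        (solve 8 (λ A B C Dd P R w d →
             ((A :* ((P :- Dd) :* w) :+ d :* con 0ℚ :* (R :* w)) :+ B) :- (P :* ((P :- Dd) :* w) :+ d :* R :* (R :* w))
          := w :* P :* ((A :+ Dd) :- (P :+ P)) :+ w :* ((P :* P :- d :* R :* R) :- (A :* Dd :- B :* C)) :- B :* (C :* w :- con 1ℚ))
          refl A B C Dd P R w δ)
        (trans (cong₂ (λ x y → w * P * x + w * y - B * (C * w - 1ℚ)) T≡0 N≡0)
          (trans (cong (λ z → w * P * 0ℚ + w * 0ℚ - B * z) Cw-1≡0)
          (solve 3 (λ w P B → w :* P :* con 0ℚ :+ w :* con 0ℚ :- B :* con 0ℚ := con 0ℚ) refl w P B)))
      aβ+b≡ηβ₂ : (A * (R * w) + 0ℚ * ((P - Dd) * w)) + 0ℚ ≡ P * (R * w) + R * ((P - Dd) * w)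
      aβ+b≡ηβ₂ = via-difference (R * w * ((A + Dd) - (P + P)))
        (solve 6 (λ A Dd P R w d →
             ((A :* (R :* w) :+ con 0ℚ :* ((P :- Dd) :* w)) :+ con 0ℚ) :- (P :* (R :* w) :+ R :* ((P :- Dd) :* w))
          := R :* w :* ((A :+ Dd) :- (P :+ P)))
          refl A Dd P R w δ)
        (trans (cong (R * w *_) T≡0) (ℚ.*-zeroʳ (R * w)))
      cβ+d≡η₁ : (C * ((P - Dd) * w) + δ * 0ℚ * (R * w)) + Dd ≡ P
      cβ+d≡η₁ = via-difference ((P - Dd) * (C * w - 1ℚ))
        (solve 6 (λ C Dd P R w d → ((C :* ((P :- Dd) :* w) :+ d :* con 0ℚ :* (R :* w)) :+ Dd) :- P
                                   := (P :- Dd) :* (C :* w :- con 1ℚ))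
          refl C Dd P R w δ)
        (trans (cong ((P - Dd) *_) Cw-1≡0) (ℚ.*-zeroʳ (P - Dd)))
      cβ+d≡η₂ : (C * (R * w) + 0ℚ * ((P - Dd) * w)) + 0ℚ ≡ R
      cβ+d≡η₂ = via-difference (R * (C * w - 1ℚ))
        (solve 5 (λ C Dd P R w → ((C :* (R :* w) :+ con 0ℚ :* ((P :- Dd) :* w)) :+ con 0ℚ) :- R
                                 := R :* (C :* w :- con 1ℚ))
          refl C Dd P R w)
        (trans (cong (R *_) Cw-1≡0) (ℚ.*-zeroʳ R))

    -- The root is the eigenvalue c β + d of the eigenvector (β : 1).
    unital⇒eigenvalue : ∀ γ → Unital D γ → ∃ λ η → CharPoly D η (a γ ℤ.+ d γ) (det γ)
    unital⇒eigenvalue (mat a b c d) ((p , q) , q≢0 , _ , _ , aβ+b≡lβ , refl) = l , trace , norm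
      where open EigenvectorEquation {a} {b} {c} {d} {p} {q} q≢0 aβ+b≡lβ

    -- The fixed point is β = (η - d) / c, with eigenvalue η.
    eigenvalue⇒unital : ∀ γ η → c γ ≢ + 0 → NotRational η → CharPoly D η (a γ ℤ.+ d γ) (det γ) → Unital D γ
    eigenvalue⇒unital (mat a b c d) (P , R) c≢0 R≢0 (tr , nm) =
      β , (λ Rw≡0 → R≢0 (*-cancelʳ-≢0 R w≢0 Rw≡0)) , (P , R) , (λ η≡0 → R≢0 (cong proj₂ η≡0)) ,
      cong₂ _,_ aβ+b≡ηβ₁ aβ+b≡ηβ₂ , cong₂ _,_ cβ+d≡η₁ cβ+d≡η₂
      where open FixedPoint {a} {b} {c} {d} {P} {R} c≢0 tr nm

module UnitalMatrices where

  open import Data.Nat as ℕ using (ℕ; suc)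
  import Data.Nat.Properties as ℕ
  open import Data.Integer using (ℤ; +_; -_; _+_; _-_; _*_; 0ℤ; 1ℤ; ∣_∣; -[1+_])
  import Data.Integer.Properties as ℤ
  open import Data.Integer.Divisibility using () renaming (_∣_ to _∣ℤ_)
  open import Data.Integer.Divisibility.Signed using (divides; ∣⇒∣ᵤ; ∣ᵤ⇒∣; ∣m∣n⇒∣m+n; ∣n⇒∣m*n)
    renaming (_∣_ to _∣ˢ_)
  open import Data.Integer.Tactic.RingSolver using (solve-∀; solve)
  open import Data.Rational using (0ℚ)
  import Data.Rational.Properties as ℚ
  open import Data.List using ([]; _∷_)
  open import Data.Product using (∃; _×_; _,_)
  open import Data.Sum using (_⊎_; inj₁; inj₂) renaming (map to ⊎-map)
  open import Relation.Binary.PropositionalEquality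
  open import Relation.Nullary using (yes; no)
  open DiophantineApproximation using (square-cancel-≤)
  open CongruentPell using (*-≢0; square-pos; pell-solution-≡1-mod)
  open RationalEmbedding
  open QuadraticFieldAlgebra
  open MatrixEigenvalues

  UnitalLift : ℕ → ℕ → ℤ → ℤ → Set
  UnitalLift D N x n = ∃ λ (γ : M2) → InGL2 γ × Unital D γ × det γ ≡ n ×
    a γ ≡[mod N ] x × c γ ≡[mod N ] (+ 0) × ((x' : ℤ) → (x * x') ≡[mod N ] (+ 1) → d γ ≡[mod N ] (n * x'))

  -- The companion-like matrix (x, -k; N, t - x), where x² - t x + n = k N, has trace t and determinant n.
  unital-lift : ∀ D N → 1 ℕ.≤ N → ∀ η {t n} → NotRational η → CharPoly D η t n → n ≡ + 1 ⊎ n ≡ - (+ 1) →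
                ∀ x → RootMod N t n x → UnitalLift D N x n
  unital-lift D N@(suc _) _ η {t} {n} η∉ℚ cp n≡±1 x root with ∣ᵤ⇒∣ root
  ... | divides k root≡kN =
    γ , InGL2-γ , unital , det≡n , a≡x , c≡0 , d≡nx′
    where
    γ : M2
    γ = mat x (- k) (+ N) (t - x)
    det≡n : det γ ≡ n
    det≡n = begin
      x * (t - x) - - k * + N                     ≡⟨ rearrange-det x t n k (+ N) ⟩
      n - (x * x - t * x + n - + 0) + k * + N     ≡⟨ cong (λ r → n - r + k * + N) root≡kN ⟩
      n - k * + N + k * + N                       ≡⟨ cancel n (k * + N) ⟩
      n                                           ∎
      where
      open ≡-Reasoning
      rearrange-det : ∀ x t n k N → x * (t - x) - - k * N ≡ n - (x * x - t * x + n - 0ℤ) + k * N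
      rearrange-det = solve-∀
      cancel : ∀ n y → n - y + y ≡ n
      cancel = solve-∀
    trace≡t : x + (t - x) ≡ t
    trace≡t = solve (x ∷ t ∷ [])
    InGL2-γ : InGL2 γ
    InGL2-γ = ⊎-map (trans det≡n) (trans det≡n) n≡±1
    unital : Unital D γ
    unital = Eigenvalues.eigenvalue⇒unital D γ η (λ ()) η∉ℚ (subst₂ (CharPoly D η) (sym trace≡t) (sym det≡n) cp)
    d≡nx′ : (x′ : ℤ) → (x * x′) ≡[mod N ] (+ 1) → (t - x) ≡[mod N ] (n * x′)
    d≡nx′ x′ xx′≡1 = ∣⇒∣ᵤ {+ N} {(t - x) - n * x′} (subst (+ N ∣ˢ_) (sym (combination x t n x′))
      (∣m∣n⇒∣m+n (∣n⇒∣m*n (- x′) (∣ᵤ⇒∣ root)) (∣n⇒∣m*n (x - t) (∣ᵤ⇒∣ xx′≡1))))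
      where
      combination : ∀ x t n x′ → (t - x) - n * x′ ≡ - x′ * (x * x - t * x + n - 0ℤ) + (x - t) * (x * x′ - 1ℤ)
      combination = solve-∀
    a≡x : x ≡[mod N ] x
    a≡x = ∣⇒∣ᵤ {+ N} {x - x} (divides 0ℤ (x-x≡0*N x (+ N)))
      where
      x-x≡0*N : ∀ x N → x - x ≡ 0ℤ * N
      x-x≡0*N = solve-∀
    c≡0 : (+ N) ≡[mod N ] (+ 0)
    c≡0 = ∣⇒∣ᵤ {+ N} {+ N - + 0} (divides 1ℤ (N-0≡1*N (+ N)))
      where
      N-0≡1*N : ∀ N → N - 0ℤ ≡ 1ℤ * N
      N-0≡1*N = solve-∀

  rational-unit-trace : ∀ {t n} → t * t ≡ + 4 * n → n ≡ + 1 ⊎ n ≡ - (+ 1) →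
                        n ≡ + 1 × ∃ λ s → s * s ≡ 1ℤ × t ≡ s + s
  rational-unit-trace {t} t²≡4n (inj₂ refl) with () ← trans (sym (square-pos t)) t²≡4n
  rational-unit-trace {t} t²≡4n (inj₁ refl) = refl , sign-of t ∣t∣≡2
    where
    ∣t∣²≡4 : ∣ t ∣ ℕ.* ∣ t ∣ ≡ 4
    ∣t∣²≡4 = ℤ.+-injective (trans (sym (square-pos t)) t²≡4n)
    ∣t∣≡2 : ∣ t ∣ ≡ 2
    ∣t∣≡2 = ℕ.≤-antisym (square-cancel-≤ (ℕ.≤-reflexive ∣t∣²≡4)) (square-cancel-≤ (ℕ.≤-reflexive (sym ∣t∣²≡4)))
    sign-of : ∀ t → ∣ t ∣ ≡ 2 → ∃ λ s → s * s ≡ 1ℤ × t ≡ s + s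
    sign-of (+ .2)      refl = 1ℤ , refl , refl
    sign-of -[1+ .1 ] refl = - 1ℤ , refl , refl

  -- The unit s (u + v √D), for a solution of Pell's equation with u ≡ 1 (mod N), has trace 2 s u ≡ 2 s (mod N).
  pell-lift : ∀ D → 1 ℕ.< D → Squarefree D → ∀ N → 1 ℕ.≤ N → ∀ s → s * s ≡ 1ℤ →
              ∀ x → RootMod N (s + s) (+ 1) x → UnitalLift D N x (+ 1)
  pell-lift D 1<D squarefree N 1≤N s s²≡1 x root =
    let sol , N∣u-1 = pell-solution-≡1-mod D 1<D squarefree N 1≤N
        open PellSolutions.PellSolution sol
    in unital-lift D N 1≤N (ℤ→ℚ (s * u) , ℤ→ℚ (s * v)) {s * u + s * u} {+ 1}
         (λ sv≡0 → *-≢0 {s} {v} s≢0 v≢0 (ℤ→ℚ-injective sv≡0))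
         (subst (CharPoly D (ℤ→ℚ (s * u) , ℤ→ℚ (s * v)) (s * u + s * u))
                (trans (scale-norm s u (+ D) v) (cong₂ _*_ s²≡1 u²-Dv²≡1))
                (QuadraticField.ℤ[√D]-charPoly D (s * u) (s * v)))
         (inj₁ refl) x
         (∣⇒∣ᵤ {+ N} {x * x - (s * u + s * u) * x + + 1 - + 0}
           (subst (+ N ∣ˢ_) (sym (shift-trace x s u))
             (∣m∣n⇒∣m+n {+ N} {x * x - (s + s) * x + + 1 - + 0} (∣ᵤ⇒∣ root) (∣n⇒∣m*n (- (s + s) * x) N∣u-1))))
    where
    s≢0 : s ≢ 0ℤ
    s≢0 s≡0 with () ← trans (sym s²≡1) (cong (λ s → s * s) s≡0)
    scale-norm : ∀ s u d v → s * u * (s * u) - d * (s * v * (s * v)) ≡ s * s * (u * u - d * (v * v))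
    scale-norm = solve-∀
    shift-trace : ∀ x s u → x * x - (s * u + s * u) * x + 1ℤ - 0ℤ
                            ≡ (x * x - (s + s) * x + 1ℤ - 0ℤ) + - (s + s) * x * (u - 1ℤ)
    shift-trace = solve-∀

  rational-lift : ∀ D → 1 ℕ.< D → Squarefree D → ∀ N → 1 ℕ.≤ N → ∀ P {t n} → CharPoly D (P , 0ℚ) t n →
                  n ≡ + 1 ⊎ n ≡ - (+ 1) → ∀ x → RootMod N t n x → UnitalLift D N x n
  rational-lift D 1<D squarefree N 1≤N P {t} {n} cp n≡±1 x root =
    let n≡1 , s , s²≡1 , t≡s+s = rational-unit-trace {t} {n} (QuadraticField.rational-charPoly D {P} {t} {n} cp) n≡±1
    in subst (UnitalLift D N x) (sym n≡1)
         (pell-lift D 1<D squarefree N 1≤N s s²≡1 x (subst₂ (λ t n → RootMod N t n x) t≡s+s n≡1 root))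

  det²≡1 : ∀ γ → InGL2 γ → det γ * det γ ≡ + 1
  det²≡1 γ (inj₁ det≡1)  rewrite det≡1 = refl
  det²≡1 γ (inj₂ det≡-1) rewrite det≡-1 = refl

  upper-left-root : ∀ N γ → (+ N) ∣ℤ c γ → RootMod N (a γ + d γ) (det γ) (a γ)
  upper-left-root N (mat a b c d) N∣c = ∣⇒∣ᵤ {+ N} {a * a - (a + d) * a + (a * d - b * c) - + 0}
    (subst (+ N ∣ˢ_) (sym (char-poly-at-a a b c d)) (∣n⇒∣m*n (- b) (∣ᵤ⇒∣ N∣c)))
    where
    char-poly-at-a : ∀ a b c d → a * a - (a + d) * a + (a * d - b * c) - 0ℤ ≡ - b * c
    char-poly-at-a = solve-∀

  unit-root⇒unital-lift : ∀ D → 1 ℕ.< D → Squarefree D → ∀ N → 1 ℕ.≤ N →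
    (η : E) → IsUnitO D η → (t n : ℤ) → CharPoly D η t n → (x : ℤ) → UnitMod N x → RootMod N t n x → UnitalLift D N x n
  unit-root⇒unital-lift D 1<D squarefree N 1≤N (P , R) unit t n cp x _ root with R ℚ.≟ 0ℚ
  ... | no  R≢0 = unital-lift D N 1≤N (P , R) {t} {n} R≢0 cp (QuadraticField.unit-norm-±1 D {P , R} {t} {n} unit cp) x root
  ... | yes refl = rational-lift D 1<D squarefree N 1≤N P {t} {n} cp (QuadraticField.unit-norm-±1 D {P , 0ℚ} {t} {n} unit cp) x root

  unital⇒unit-root : ∀ D N (γ : M2) → InΓ0± N γ → Unital D γ →
    ∃ λ (η : E) → IsUnitO D η × ∃ λ (t : ℤ) → ∃ λ (n : ℤ) → CharPoly D η t n × n ≡ det γ × RootMod N t n (a γ)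
  unital⇒unit-root D N γ (gl , N∣c) unital =
    let η , cp = Eigenvalues.unital⇒eigenvalue D γ unital
    in η , QuadraticField.charPoly-unit D {η} {a γ + d γ} {det γ} cp (det²≡1 γ gl) ,
       a γ + d γ , det γ , cp , refl , upper-left-root N γ N∣c

open import Data.Nat using (ℕ; _≤_; _<_)
open import Data.Integer using (ℤ; +_; _*_)
open import Data.Product using (_×_; ∃; _,_)
open import Relation.Binary.PropositionalEquality using (_≡_)
open UnitalMatrices using (unit-root⇒unital-lift; unital⇒unit-root)

lemma10p3 : (D : ℕ) → 1 < D → Squarefree D → (N : ℕ) → 1 ≤ N →
    ((η : E) → IsUnitO D η → (t n : ℤ) → CharPoly D η t n →
      (x : ℤ) → UnitMod N x → RootMod N t n x →
      ∃ λ (γ : M2) → InGL2 γ × Unital D γ × det γ ≡ n ×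
        a γ ≡[mod N ] x × c γ ≡[mod N ] (+ 0) ×
        ((x' : ℤ) → (x * x') ≡[mod N ] (+ 1) → d γ ≡[mod N ] (n * x')))
    ×
    ((γ : M2) → InΓ0± N γ → Unital D γ →
      ∃ λ (η : E) → IsUnitO D η × ∃ λ (t : ℤ) → ∃ λ (n : ℤ) →
        CharPoly D η t n × n ≡ det γ × RootMod N t n (a γ))
lemma10p3 D 1<D squarefree N 1≤N = unit-root⇒unital-lift D 1<D squarefree N 1≤N , unital⇒unit-root D N
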